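{- Let $r\ge1$ and $k=m_0>m_1>\dots>m_r>0$ be integers. Then $$\bigl(1-xR_{m_0-m_1-1}(x)-xR_{m_r}(x)\bigr)F_{[m_0,\dots,m_r]}(x)=1-xR_{m_0-m_1-1}(x)F_{[m_1,\dots,m_r]}(x)+x\sum_{j=2}^rF_{[m_0-m_j,\dots,m_{j-1}-m_j]}(x)\bigl(F_{[m_{j-1},\dots,m_r]}(x)-F_{[m_j,\dots,m_r]}(x)\bigr).$$
   Context: A permutation $\alpha\in S_n$ contains a pattern $\tau\in S_k$ if there are indices $1\le i_1<\dots<i_k\le n$ with $(\alpha_{i_1},\dots,\alpha_{i_k})$ order-isomorphic to $\tau$; otherwise it avoids $\tau$. For a pattern $\tau$, $f_\tau(n)$ is the number of permutations in $S_n$ avoiding both $132$ and $\tau$ ($S_0$ consists of the empty permutation), and $F_\tau(x)=\sum_{n\ge0}f_\tau(n)x^n$. Layered patterns: for integers $m_0>m_1>\dots>m_r>m_{r+1}=0$, $[m_0,\dots,m_r]$ denotes the permutation of $\{1,\dots,m_0\}$ given by $(m_1+1,m_1+2,\dots,m_0,\ m_2+1,\dots,m_1,\ \dots,\ 1,2,\dots,m_r)$, i.e. the concatenation of the increasing blocks $(m_{i+1}+1,\dots,m_i)$, $i=0,\dots,r$; in particular $[k]=(1,2,\dots,k)$. $U_p$ is the Chebyshev polynomial of the second kind, $U_p(\cos\theta)=\sin((p+1)\theta)/\sin\theta$, with $U_{ -1}=0$. For $p\ge0$, $R_p(x)=\dfrac{U_{p-1}\left(\frac1{2\sqrt x}\right)}{\sqrt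 x\,U_p\left(\frac1{2\sqrt x}\right)}$ (a rational function of $x$; $R_0=0$). -}

module Defs where

open import Data.Nat using (ℕ; zero; suc; _∸_; _<ᵇ_) renaming (_+_ to _+ℕ_)
import Data.Nat
open import Data.Bool using (Bool; true; false; _∧_; not; if_then_else_)
open import Data.Bool.Properties using () renaming (_≟_ to _≟B_)
open import Data.Integer using (ℤ; +_) renaming (_+_ to _+ℤ_; _*_ to _*ℤ_; _-_ to _-ℤ_)
open import Data.List using (List; []; _∷_; _++_; map; upTo; length; concatMap; foldr)
open import Relation.Binary.PropositionalEquality using (_≡_)
open import Relation.Nullary.Decidable using (⌊_⌋)

inserts : ℕ → List ℕ → List (List ℕ)
inserts a [] = (a ∷ []) ∷ []
inserts a (b ∷ bs) = (a ∷ b ∷ bs) ∷ map (b ∷_) (inserts a bs)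

-- all permutations of (1,2,…,n), as lists of values (one-line notation); S_0 = {empty}
perms : ℕ → List (List ℕ)
perms zero = [] ∷ []
perms (suc n) = concatMap (inserts (suc n)) (perms n)

-- all subsequences (as lists of entries, possibly with repetition of equal subsequences)
subseqs : List ℕ → List (List ℕ)
subseqs [] = [] ∷ []
subseqs (a ∷ as) = map (a ∷_) (subseqs as) ++ subseqs as

anyB : {A : Set} → (A → Bool) → List A → Bool
anyB p = foldr (λ a b → if p a then true else b) false

allB : {A : Set} → (A → Bool) → List A → Bool
allB p = foldr (λ a b → if p a then b else false) true

agree : ℕ → List ℕ → ℕ → List ℕ → Bool
agree a [] b [] = true
agree a (a' ∷ as) b (b' ∷ bs) =
  ⌊ (a <ᵇ a') ≟B (b <ᵇ b') ⌋ ∧ ⌊ (a' <ᵇ a) ≟B (b' <ᵇ b) ⌋ ∧ agree a as b bs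
agree a _ b _ = false

orderIso : List ℕ → List ℕ → Bool
orderIso [] [] = true
orderIso (a ∷ as) (b ∷ bs) = agree a as b bs ∧ orderIso as bs
orderIso _ _ = false

contains : List ℕ → List ℕ → Bool
contains α τ = anyB (λ s → orderIso s τ) (subseqs α)

avoids : List ℕ → List ℕ → Bool
avoids α τ = not (contains α τ)

p132 : List ℕ
p132 = 1 ∷ 3 ∷ 2 ∷ []

countB : {A : Set} → (A → Bool) → List A → ℕ
countB p l = foldr Data.Nat._+_ 0 (map (λ a → if p a then 1 else 0) l)

f : List ℕ → ℕ → ℕ
f τ n = countB (λ α → avoids α p132 ∧ avoids α τ) (perms n)

block : ℕ → ℕ → List ℕ
block lo hi = map (λ i → lo +ℕ suc i) (upTo (hi ∸ lo))

layered : List ℕ → List ℕ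
layered [] = []
layered (a ∷ []) = block 0 a
layered (a ∷ b ∷ t) = block b a ++ layered (b ∷ t)

-- inclusive range a..b (empty if b < a)
range : ℕ → ℕ → List ℕ
range a b = map (a +ℕ_) (upTo (suc b ∸ a))

Series : Set
Series = ℕ → ℤ

_≈_ : Series → Series → Set
A ≈ B = ∀ n → A n ≡ B n
infix 4 _≈_

infixl 6 _⊕_ _⊖_
infixl 7 _⊛_

_⊕_ : Series → Series → Series
(A ⊕ B) n = A n +ℤ B n

_⊖_ : Series → Series → Series
(A ⊖ B) n = A n -ℤ B n

_⊛_ : Series → Series → Series
(A ⊛ B) n = foldr _+ℤ_ (+ 0) (map (λ i → A i *ℤ B (n ∸ i)) (range 0 n))

one : Series
one zero = + 1
one (suc n) = + 0

zeroS : Series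
zeroS n = + 0

X : Series
X zero = + 0
X (suc zero) = + 1
X (suc (suc n)) = + 0

sumS : List Series → Series
sumS = foldr _⊕_ zeroS

F : List ℕ → Series
F τ n = + f τ n

-- P p = (√x)^p U_p(1/(2√x)), a polynomial in x:
-- P 0 = 1, P 1 = 1, P (p+2) = P (p+1) - x P p   (from U_{p+1} = 2t U_p - U_{p-1}).
P : ℕ → Series
P zero = one
P (suc zero) = one
P (suc (suc p)) = P (suc p) ⊖ X ⊛ P p

-- Division C / D of power series where D 0 = 1:
-- Q n = C n - Σ_{i=1}^{n} D i * Q (n-i).
-- qlist n = [Q n, Q (n-1), …, Q 0]
conv : Series → List ℤ → ℕ → ℤ
conv D [] i = + 0
conv D (q ∷ qs) i = D (suc i) *ℤ q +ℤ conv D qs (suc i)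

qlist : Series → Series → ℕ → List ℤ
qlist C D zero = C 0 ∷ []
qlist C D (suc n) = (C (suc n) -ℤ conv D (qlist C D n) 0) ∷ qlist C D n

headZ : List ℤ → ℤ
headZ [] = + 0
headZ (q ∷ _) = q

divS : Series → Series → Series
divS C D n = headZ (qlist C D n)

-- R_p = U_{p-1}(1/(2√x)) / (√x U_p(1/(2√x))) = P (p-1) / P p, R_0 = 0.
R : ℕ → Series
R zero = zeroS
R (suc p) = divS (P p) (P (suc p))

-- Every 132-avoiding permutation of [1..n+1] factors as α = (β + c) (n+1) γ, with β and γ
-- 132-avoiding and every entry left of the maximum above every entry right of it. Such an α
-- contains the layered pattern τ = [m₀,…,m_r] iff τ can be cut at a layer boundary m₀ − m_j
-- into a prefix contained in (β + c)(n+1) and a suffix contained in γ, and since n+1 can only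
-- play the top of the first layer, the prefix condition says that β contains the first
-- m₀ − m_j entries of τ (m₀ − m₁ − 1 entries when j = 1). Both conditions are monotone in j,
-- so inclusion–exclusion telescopes to F_τ = 1 + x Σ_j (A_{j+1} − A_j) B_j, where A_j and B_j
-- are the generating functions of these prefixes and suffixes. For a single layer this reads
-- F_[k+1] = 1 + x F_[k] F_[k+1], which identifies F_[k] with R_k. Summation by parts together
-- with A_0 = 0, A_{r+1} = B_0 = F_τ, A_1 = R_{m₀−m₁−1} and B_r = R_{m_r} then yields a linear
-- equation for F_τ.

{-# OPTIONS --safe #-}
module Submission where

open import Defs
open import Algebra.Bundles using (CommutativeRing; AbelianGroup)
import Algebra.Solver.Ring as RingSolver
import Algebra.Solver.Ring.AlmostCommutativeRing as ACR
open import Data.Bool using (Bool; true; false; _∧_; not; if_then_else_; T)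
import Data.Bool.Properties as BP
open import Data.Bool.Properties using () renaming (_≟_ to _≟B_)
open import Data.Empty using (⊥; ⊥-elim)
open import Data.Integer as Z using (ℤ; 0ℤ; 1ℤ; -_) renaming (_+_ to _+ℤ_; _*_ to _*ℤ_; _-_ to _-ℤ_)
import Data.Integer.Properties as ZP
open import Algebra.Properties.Group (AbelianGroup.group ZP.+-0-abelianGroup) using () renaming (∙-cancelʳ to +ℤ-cancelʳ)
open import Data.Integer.Solver using (module +-*-Solver)
open import Data.List as L using (List; []; _∷_; _++_; map; upTo; applyUpTo; foldr; length; take; drop)
import Data.List.Properties as Lp
open import Data.List.Membership.Propositional using (_∈_)
import Data.List.Membership.Propositional.Properties as Mp
open import Data.List.Relation.Binary.Permutation.Propositional using (_↭_; ↭-sym; ↭-reflexive; prep; swap; ↭⇒↭ₛ) renaming (refl to prefl; trans to ptrans)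
import Data.List.Relation.Binary.Permutation.Setoid.Properties as PermSetoid
import Data.List.Relation.Binary.Permutation.Propositional.Properties as PP
open import Data.List.Relation.Unary.All as All using (All; []; _∷_)
import Data.List.Relation.Unary.All.Properties as AllP
open import Data.List.Relation.Binary.Sublist.Propositional using (_⊆_; []; _∷_; _∷ʳ_; minimum; from∈; ⊆-refl; ⊆-trans)
open import Data.List.Relation.Binary.Sublist.Propositional.Properties using (++⁺; ++⁺ˡ; ++⁺ʳ; map⁺; take-⊆; drop-⊆; All-resp-⊆)
open import Data.List.Relation.Unary.AllPairs using ([]; _∷_)
open import Data.List.Relation.Unary.Any using (here; there)
open import Data.List.Relation.Unary.Unique.Propositional using (Unique)
import Data.List.Relation.Unary.Unique.Propositional.Properties as UP
open import Data.Maybe using (Maybe; just; nothing)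
open import Data.Nat as N using (ℕ; zero; suc; _∸_; _≤_; _<_; z≤n; s≤s; _<ᵇ_; _+_)
import Data.Nat.Properties as NP
open import Data.Product using (_×_; _,_; proj₁; proj₂; ∃-syntax)
open import Data.Sum using (_⊎_; inj₁; inj₂)
open import Function using (_∘_; id)
open import Relation.Binary.Definitions using (tri<; tri≈; tri>)
open import Relation.Binary.PropositionalEquality as Eq using (_≡_; _≢_; refl; sym; trans; cong; cong₂; subst)
import Relation.Binary.Reasoning.Setoid as SetoidR
open import Relation.Nullary using (¬_; yes; no)
open import Relation.Nullary.Decidable using (⌊_⌋)

-- Finite sums and formal power series

sumTo : (ℕ → ℤ) → ℕ → ℤ
sumTo g zero = 0ℤ
sumTo g (suc n) = g 0 +ℤ sumTo (g ∘ suc) n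

sumTo-cong : ∀ (g h : ℕ → ℤ) n → (∀ i → i < n → g i ≡ h i) → sumTo g n ≡ sumTo h n
sumTo-cong g h zero e = refl
sumTo-cong g h (suc n) e = cong₂ _+ℤ_ (e 0 (s≤s z≤n)) (sumTo-cong (g ∘ suc) (h ∘ suc) n (λ i p → e (suc i) (s≤s p)))

sumTo-+ : ∀ (g h : ℕ → ℤ) n → sumTo (λ i → g i +ℤ h i) n ≡ sumTo g n +ℤ sumTo h n
sumTo-+ g h zero = refl
sumTo-+ g h (suc n) rewrite sumTo-+ (g ∘ suc) (h ∘ suc) n = medial (g 0) (h 0) (sumTo (g ∘ suc) n) (sumTo (h ∘ suc) n)
  where
  open +-*-Solver
  medial : ∀ a b c d → (a +ℤ b) +ℤ (c +ℤ d) ≡ (a +ℤ c) +ℤ (b +ℤ d)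
  medial = solve 4 (λ a b c d → (a :+ b) :+ (c :+ d) := (a :+ c) :+ (b :+ d)) refl

sumTo-*ˡ : ∀ (c : ℤ) (g : ℕ → ℤ) n → sumTo (λ i → c *ℤ g i) n ≡ c *ℤ sumTo g n
sumTo-*ˡ c g zero = sym (ZP.*-zeroʳ c)
sumTo-*ˡ c g (suc n) rewrite sumTo-*ˡ c (g ∘ suc) n = sym (ZP.*-distribˡ-+ c (g 0) (sumTo (g ∘ suc) n))

sumTo-zero : ∀ (g : ℕ → ℤ) n → (∀ i → g i ≡ 0ℤ) → sumTo g n ≡ 0ℤ
sumTo-zero g zero e = refl
sumTo-zero g (suc n) e rewrite e 0 | sumTo-zero (g ∘ suc) n (λ i → e (suc i)) = refl

sumTo-swap : ∀ (h : ℕ → ℕ → ℤ) m L → sumTo (λ i → sumTo (λ j → h j i) L) m ≡ sumTo (λ j → sumTo (λ i → h j i) m) L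
sumTo-swap h zero L = sym (sumTo-zero _ L (λ _ → refl))
sumTo-swap h (suc m) L = trans (cong (sumTo (λ j → h j 0) L +ℤ_) (sumTo-swap (λ j i → h j (suc i)) m L))
                           (sym (sumTo-+ (λ j → h j 0) (λ j → sumTo (λ i → h j (suc i)) m) L))

foldr-applyUpTo : ∀ {A : Set} (g : A → ℤ) (f : ℕ → A) m → foldr _+ℤ_ 0ℤ (map g (applyUpTo f m)) ≡ sumTo (g ∘ f) m
foldr-applyUpTo g f zero = refl
foldr-applyUpTo g f (suc m) = cong (g (f 0) +ℤ_) (foldr-applyUpTo g (f ∘ suc) m)

tailS : Series → Series
tailS A i = A (suc i)

cauchy : Series → Series → Series
cauchy A B n = sumTo (λ i → A i *ℤ B (n ∸ i)) (suc n)

⊛-cauchy : ∀ A B n → (A ⊛ B) n ≡ cauchy A B n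
⊛-cauchy A B n = trans (cong (foldr _+ℤ_ 0ℤ) (sym (Lp.map-∘ {g = λ i → A i *ℤ B (n ∸ i)} {f = N._+_ 0} (upTo (suc n))))) (foldr-applyUpTo (λ i → A i *ℤ B (n ∸ i)) id (suc n))

cauchy-congˡ : ∀ A A' B n → (∀ i → A i ≡ A' i) → cauchy A B n ≡ cauchy A' B n
cauchy-congˡ A A' B n e = sumTo-cong _ _ (suc n) (λ i _ → cong (_*ℤ B (n ∸ i)) (e i))

cauchy-congʳ : ∀ A B B' n → (∀ i → B i ≡ B' i) → cauchy A B n ≡ cauchy A B' n
cauchy-congʳ A B B' n e = sumTo-cong _ _ (suc n) (λ i _ → cong (A i *ℤ_) (e (n ∸ i)))

cauchy-distribʳ : ∀ A B C n → cauchy (λ i → A i +ℤ B i) C n ≡ cauchy A C n +ℤ cauchy B C n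
cauchy-distribʳ A B C n = trans (sumTo-cong _ _ (suc n) (λ i _ → ZP.*-distribʳ-+ (C (n ∸ i)) (A i) (B i)))
                      (sumTo-+ (λ i → A i *ℤ C (n ∸ i)) (λ i → B i *ℤ C (n ∸ i)) (suc n))

cauchy-*ˡ : ∀ c A B n → cauchy (λ i → c *ℤ A i) B n ≡ c *ℤ cauchy A B n
cauchy-*ˡ c A B n = trans (sumTo-cong _ _ (suc n) (λ i _ → ZP.*-assoc c (A i) (B (n ∸ i))))
                      (sumTo-*ˡ c (λ i → A i *ℤ B (n ∸ i)) (suc n))

cauchy-zeroˡ : ∀ A B n → (∀ i → A i ≡ 0ℤ) → cauchy A B n ≡ 0ℤ
cauchy-zeroˡ A B n e = sumTo-zero _ (suc n) (λ i → trans (cong (_*ℤ B (n ∸ i)) (e i)) (ZP.*-zeroˡ (B (n ∸ i))))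

cauchy-identityˡ : ∀ B n → cauchy one B n ≡ B n
cauchy-identityˡ B zero = trans (ZP.+-identityʳ _) (ZP.*-identityˡ (B 0))
cauchy-identityˡ B (suc n) = trans (cong₂ _+ℤ_ (ZP.*-identityˡ (B (suc n))) (cauchy-zeroˡ (tailS one) B n (λ i → refl))) (ZP.+-identityʳ _)

cauchy-assoc : ∀ n A B C → cauchy (cauchy A B) C n ≡ cauchy A (cauchy B C) n
cauchy-assoc zero A B C = regroup (A 0) (B 0) (C 0)
  where
  open +-*-Solver
  regroup : ∀ a b c → ((a *ℤ b +ℤ 0ℤ) *ℤ c) +ℤ 0ℤ ≡ a *ℤ (b *ℤ c +ℤ 0ℤ) +ℤ 0ℤ
  regroup = solve 3 (λ a b c → ((a :* b :+ con 0ℤ) :* c) :+ con 0ℤ := a :* (b :* c :+ con 0ℤ) :+ con 0ℤ) refl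
cauchy-assoc (suc n) A B C =
  begin
    cauchy A B 0 *ℤ C (suc n) +ℤ cauchy (λ k → A 0 *ℤ B (suc k) +ℤ cauchy (tailS A) B k) C n
  ≡⟨ cong (cauchy A B 0 *ℤ C (suc n) +ℤ_) (trans (cauchy-distribʳ (λ k → A 0 *ℤ B (suc k)) (cauchy (tailS A) B) C n) (cong₂ _+ℤ_ (cauchy-*ˡ (A 0) (tailS B) C n) (cauchy-assoc n (tailS A) B C))) ⟩
    cauchy A B 0 *ℤ C (suc n) +ℤ (A 0 *ℤ cauchy (tailS B) C n +ℤ cauchy (tailS A) (cauchy B C) n)
  ≡⟨ regroup (A 0) (B 0) (C (suc n)) (cauchy (tailS B) C n) (cauchy (tailS A) (cauchy B C) n) ⟩
    A 0 *ℤ (B 0 *ℤ C (suc n) +ℤ cauchy (tailS B) C n) +ℤ cauchy (tailS A) (cauchy B C) n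
  ∎
  where
  open +-*-Solver
  regroup : ∀ a b c d e → ((a *ℤ b +ℤ 0ℤ) *ℤ c) +ℤ (a *ℤ d +ℤ e) ≡ a *ℤ (b *ℤ c +ℤ d) +ℤ e
  regroup = solve 5 (λ a b c d e → ((a :* b :+ con 0ℤ) :* c) :+ (a :* d :+ e) := a :* (b :* c :+ d) :+ e) refl
  open Eq.≡-Reasoning

cauchy-comm : ∀ n A B → cauchy A B n ≡ cauchy B A n
cauchy-comm zero A B = cong (_+ℤ 0ℤ) (ZP.*-comm (A 0) (B 0))
cauchy-comm (suc zero) A B = left-comm (A 0) (B 1) (A 1) (B 0)
  where
  open +-*-Solver
  left-comm : ∀ a b c d → a *ℤ b +ℤ (c *ℤ d +ℤ 0ℤ) ≡ d *ℤ c +ℤ (b *ℤ a +ℤ 0ℤ)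
  left-comm = solve 4 (λ a b c d → a :* b :+ (c :* d :+ con 0ℤ) := d :* c :+ (b :* a :+ con 0ℤ)) refl
cauchy-comm (suc (suc m)) A B =
  begin
    A 0 *ℤ B (suc (suc m)) +ℤ cauchy (tailS A) B (suc m)
  ≡⟨ cong (A 0 *ℤ B (suc (suc m)) +ℤ_) (trans (cauchy-comm (suc m) (tailS A) B) (cong (B 0 *ℤ A (suc (suc m)) +ℤ_) (cauchy-comm m (tailS B) (tailS A)))) ⟩
    A 0 *ℤ B (suc (suc m)) +ℤ (B 0 *ℤ A (suc (suc m)) +ℤ cauchy (tailS A) (tailS B) m)
  ≡⟨ left-comm (A 0 *ℤ B (suc (suc m))) (B 0 *ℤ A (suc (suc m))) (cauchy (tailS A) (tailS B) m) ⟩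
    B 0 *ℤ A (suc (suc m)) +ℤ (A 0 *ℤ B (suc (suc m)) +ℤ cauchy (tailS A) (tailS B) m)
  ≡⟨ cong (B 0 *ℤ A (suc (suc m)) +ℤ_) (cauchy-comm (suc m) A (tailS B)) ⟩
    B 0 *ℤ A (suc (suc m)) +ℤ cauchy (tailS B) A (suc m)
  ∎
  where
  open +-*-Solver
  left-comm : ∀ a b c → a +ℤ (b +ℤ c) ≡ b +ℤ (a +ℤ c)
  left-comm = solve 3 (λ a b c → a :+ (b :+ c) := b :+ (a :+ c)) refl
  open Eq.≡-Reasoning

negS : Series → Series
negS A n = - A n

⊛-cong : ∀ {A A' B B'} → A ≈ A' → B ≈ B' → A ⊛ B ≈ A' ⊛ B'
⊛-cong {A} {A'} {B} {B'} e1 e2 n = trans (⊛-cauchy A B n) (trans (cauchy-congˡ A A' B n e1) (trans (cauchy-congʳ A' B B' n e2) (sym (⊛-cauchy A' B' n))))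

⊛-comm : ∀ A B → A ⊛ B ≈ B ⊛ A
⊛-comm A B n = trans (⊛-cauchy A B n) (trans (cauchy-comm n A B) (sym (⊛-cauchy B A n)))

⊛-assoc : ∀ A B C → (A ⊛ B) ⊛ C ≈ A ⊛ (B ⊛ C)
⊛-assoc A B C n = begin
    ((A ⊛ B) ⊛ C) n ≡⟨ ⊛-cauchy (A ⊛ B) C n ⟩
    cauchy (A ⊛ B) C n ≡⟨ cauchy-congˡ (A ⊛ B) (cauchy A B) C n (⊛-cauchy A B) ⟩
    cauchy (cauchy A B) C n ≡⟨ cauchy-assoc n A B C ⟩
    cauchy A (cauchy B C) n ≡⟨ sym (cauchy-congʳ A (B ⊛ C) (cauchy B C) n (⊛-cauchy B C)) ⟩
    cauchy A (B ⊛ C) n ≡⟨ sym (⊛-cauchy A (B ⊛ C) n) ⟩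
    (A ⊛ (B ⊛ C)) n ∎
  where open Eq.≡-Reasoning

⊛-identityˡ : ∀ A → one ⊛ A ≈ A
⊛-identityˡ A n = trans (⊛-cauchy one A n) (cauchy-identityˡ A n)

⊛-distribʳ : ∀ A B C → (B ⊕ C) ⊛ A ≈ (B ⊛ A) ⊕ (C ⊛ A)
⊛-distribʳ A B C n = trans (⊛-cauchy (B ⊕ C) A n) (trans (cauchy-distribʳ B C A n) (sym (cong₂ _+ℤ_ (⊛-cauchy B A n) (⊛-cauchy C A n))))

⊛-distribˡ : ∀ A B C → A ⊛ (B ⊕ C) ≈ (A ⊛ B) ⊕ (A ⊛ C)
⊛-distribˡ A B C n = trans (⊛-comm A (B ⊕ C) n) (trans (⊛-distribʳ A B C n) (cong₂ _+ℤ_ (⊛-comm B A n) (⊛-comm C A n)))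

seriesCommutativeRing : CommutativeRing _ _
seriesCommutativeRing = record
  { Carrier = Series
  ; _≈_ = _≈_
  ; _+_ = _⊕_
  ; _*_ = _⊛_
  ; -_ = negS
  ; 0# = zeroS
  ; 1# = one
  ; isCommutativeRing = record
    { isRing = record
      { +-isAbelianGroup = record
        { isGroup = record
          { isMonoid = record
            { isSemigroup = record
              { isMagma = record
                { isEquivalence = record { refl = λ n → refl ; sym = λ e n → sym (e n) ; trans = λ e1 e2 n → trans (e1 n) (e2 n) }
                ; ∙-cong = λ e1 e2 n → cong₂ _+ℤ_ (e1 n) (e2 n) }
              ; assoc = λ A B C n → ZP.+-assoc (A n) (B n) (C n) }
            ; identity = (λ A n → ZP.+-identityˡ (A n)) , (λ A n → ZP.+-identityʳ (A n)) }
          ; inverse = (λ A n → ZP.+-inverseˡ (A n)) , (λ A n → ZP.+-inverseʳ (A n))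
          ; ⁻¹-cong = λ e n → cong -_ (e n) }
        ; comm = λ A B n → ZP.+-comm (A n) (B n) }
      ; *-cong = ⊛-cong
      ; *-assoc = ⊛-assoc
      ; *-identity = ⊛-identityˡ , (λ A n → trans (⊛-comm A one n) (⊛-identityˡ A n))
      ; distrib = ⊛-distribˡ , ⊛-distribʳ }
    ; *-comm = ⊛-comm } }

seriesAlmostCommutativeRing : ACR.AlmostCommutativeRing _ _
seriesAlmostCommutativeRing = ACR.fromCommutativeRing seriesCommutativeRing

-- The ring solver interprets constants by constS, which agrees with one and zeroS only
-- pointwise; hence the explicit conversions around solver calls below.
constS : ℤ → Series
constS c n = c *ℤ one n

constS-⊛ : ∀ c B → constS c ⊛ B ≈ (λ n → c *ℤ B n)
constS-⊛ c B n = trans (⊛-cauchy (constS c) B n) (trans (cauchy-*ˡ c one B n) (cong (c *ℤ_) (cauchy-identityˡ B n)))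

ℤ⟶Series : CommutativeRing.rawRing ZP.+-*-commutativeRing ACR.-Raw-AlmostCommutative⟶ seriesAlmostCommutativeRing
ℤ⟶Series = record
  { ⟦_⟧ = constS
  ; +-homo = λ c d n → ZP.*-distribʳ-+ (one n) c d
  ; *-homo = λ c d n → trans (ZP.*-assoc c d (one n)) (sym (constS-⊛ c (constS d) n))
  ; -‿homo = λ c n → sym (ZP.neg-distribˡ-* c (one n))
  ; 0-homo = λ n → ZP.*-zeroˡ (one n)
  ; 1-homo = λ n → ZP.*-identityˡ (one n) }

constS-≟ : (c d : ℤ) → Maybe (constS c ≈ constS d)
constS-≟ c d with c ZP.≟ d
... | yes refl = just (λ n → refl)
... | no _ = nothing

module SeriesSolver = RingSolver (CommutativeRing.rawRing ZP.+-*-commutativeRing) seriesAlmostCommutativeRing ℤ⟶Series constS-≟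

module SeriesReasoning = SetoidR (CommutativeRing.setoid seriesCommutativeRing)

≈-sym : ∀ {A B} → A ≈ B → B ≈ A
≈-sym e n = sym (e n)
≡⇒≈ : ∀ {A B} → A ≡ B → A ≈ B
≡⇒≈ refl n = refl

≈-trans : ∀ {A B C} → A ≈ B → B ≈ C → A ≈ C
≈-trans e1 e2 n = trans (e1 n) (e2 n)
⊕-cong : ∀ {A A' B B'} → A ≈ A' → B ≈ B' → A ⊕ B ≈ A' ⊕ B'
⊕-cong e1 e2 n = cong₂ _+ℤ_ (e1 n) (e2 n)
⊖-cong : ∀ {A A' B B'} → A ≈ A' → B ≈ B' → A ⊖ B ≈ A' ⊖ B'
⊖-cong e1 e2 n = cong₂ _-ℤ_ (e1 n) (e2 n)

∑S : (ℕ → Series) → ℕ → Series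
∑S h zero = zeroS
∑S h (suc L) = h 0 ⊕ ∑S (h ∘ suc) L

∑S-coeff : ∀ h L n → ∑S h L n ≡ sumTo (λ j → h j n) L
∑S-coeff h zero n = refl
∑S-coeff h (suc L) n = cong (h 0 n +ℤ_) (∑S-coeff (h ∘ suc) L n)

∑S-cong : ∀ h h' L → (∀ j → j < L → h j ≈ h' j) → ∑S h L ≈ ∑S h' L
∑S-cong h h' zero e = λ n → refl
∑S-cong h h' (suc L) e = ⊕-cong {h 0} {h' 0} {∑S (h ∘ suc) L} {∑S (h' ∘ suc) L} (e 0 (s≤s z≤n)) (∑S-cong (h ∘ suc) (h' ∘ suc) L (λ j p → e (suc j) (s≤s p)))

∑S-suc : ∀ h L → ∑S h (suc L) ≈ ∑S h L ⊕ h L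
∑S-suc h zero n = trans (ZP.+-identityʳ (h 0 n)) (sym (ZP.+-identityˡ (h 0 n)))
∑S-suc h (suc L) n = trans (cong (h 0 n +ℤ_) (∑S-suc (h ∘ suc) L n)) (sym (ZP.+-assoc (h 0 n) _ _))

summation-by-parts : ∀ (a b : ℕ → Series) r → ∑S (λ j → (a (suc j) ⊖ a j) ⊛ b j) (suc r)
    ≈ a (suc r) ⊛ b r ⊖ a 0 ⊛ b 0 ⊕ ∑S (λ j → a (suc j) ⊛ (b j ⊖ b (suc j))) r
summation-by-parts a b zero = ⊕-cong {(a 1 ⊖ a 0) ⊛ b 0} {a 1 ⊛ b 0 ⊖ a 0 ⊛ b 0} {zeroS}
  (solve 3 (λ a₁ a₀ b₀ → (a₁ :- a₀) :* b₀ := a₁ :* b₀ :- a₀ :* b₀) (λ n → refl) (a 1) (a 0) (b 0)) (λ n → refl)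
  where open SeriesSolver
summation-by-parts a b (suc r) = begin
    ∑S g (suc (suc r)) ≈⟨ ∑S-suc g (suc r) ⟩
    ∑S g (suc r) ⊕ g (suc r) ≈⟨ ⊕-cong {B = g (suc r)} {B' = g (suc r)} (summation-by-parts a b r) (λ n → refl) ⟩
    (a (suc r) ⊛ b r ⊖ a 0 ⊛ b 0 ⊕ ∑S h r) ⊕ (a (suc (suc r)) ⊖ a (suc r)) ⊛ b (suc r)
      ≈⟨ solve 7 (λ ar br a0 b0 s a2 b1 → (ar :* br :- a0 :* b0 :+ s) :+ (a2 :- ar) :* b1 := a2 :* b1 :- a0 :* b0 :+ (s :+ ar :* (br :- b1)))
           (λ n → refl) (a (suc r)) (b r) (a 0) (b 0) (∑S h r) (a (suc (suc r))) (b (suc r)) ⟩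
    a (suc (suc r)) ⊛ b (suc r) ⊖ a 0 ⊛ b 0 ⊕ (∑S h r ⊕ h r) ≈⟨ ⊕-cong {A = a (suc (suc r)) ⊛ b (suc r) ⊖ a 0 ⊛ b 0} {A' = a (suc (suc r)) ⊛ b (suc r) ⊖ a 0 ⊛ b 0} (λ n → refl) (≈-sym (∑S-suc h r)) ⟩
    a (suc (suc r)) ⊛ b (suc r) ⊖ a 0 ⊛ b 0 ⊕ ∑S h (suc r) ∎
  where
  open SeriesReasoning
  open SeriesSolver
  g h : ℕ → Series
  g j = (a (suc j) ⊖ a j) ⊛ b j
  h j = a (suc j) ⊛ (b j ⊖ b (suc j))

X⊛-coeff-zero : ∀ A → (X ⊛ A) 0 ≡ 0ℤ
X⊛-coeff-zero A = trans (⊛-cauchy X A 0) (trans (ZP.+-identityʳ _) (ZP.*-zeroˡ (A 0)))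

X⊛-coeff-suc : ∀ A n → (X ⊛ A) (suc n) ≡ A n
X⊛-coeff-suc A n = trans (⊛-cauchy X A (suc n)) (trans (trans (cong (_+ℤ cauchy (tailS X) A n) (ZP.*-zeroˡ (A (suc n)))) (ZP.+-identityˡ _)) (trans (cauchy-congˡ (tailS X) one A n e) (cauchy-identityˡ A n)))
  where
  e : ∀ i → tailS X i ≡ one i
  e zero = refl
  e (suc i) = refl

-- The series R_k

P-coeff-zero : ∀ k → P k 0 ≡ 1ℤ
P-coeff-zero zero = refl
P-coeff-zero (suc zero) = refl
P-coeff-zero (suc (suc k)) rewrite P-coeff-zero (suc k) | X⊛-coeff-zero (P k) = refl

conv-qlist : ∀ C D n k → conv D (qlist C D n) k ≡ cauchy (λ i → D (suc k N.+ i)) (divS C D) n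
conv-qlist C D zero k = cong (λ z → D (suc z) *ℤ C 0 +ℤ 0ℤ) (sym (NP.+-identityʳ k))
conv-qlist C D (suc n) k =
  cong₂ _+ℤ_ (cong (λ z → D (suc z) *ℤ _) (sym (NP.+-identityʳ k)))
             (trans (conv-qlist C D n (suc k)) (cauchy-congˡ _ _ (divS C D) n (λ i → cong (λ z → D (suc z)) (sym (NP.+-suc k i)))))

⊛-divS : ∀ C D → D 0 ≡ 1ℤ → D ⊛ divS C D ≈ C
⊛-divS C D d0 zero = trans (⊛-cauchy D (divS C D) 0) (trans (cong (λ z → z *ℤ C 0 +ℤ 0ℤ) d0) (trans (ZP.+-identityʳ _) (ZP.*-identityˡ (C 0))))
⊛-divS C D d0 (suc n) = trans (⊛-cauchy D (divS C D) (suc n))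
  (trans (cong₂ _+ℤ_ (trans (cong (_*ℤ divS C D (suc n)) d0) (ZP.*-identityˡ _)) (sym (conv-qlist C D n 0)))
  (sub-add-cancel (C (suc n)) (conv D (qlist C D n) 0)))
  where
  open +-*-Solver
  sub-add-cancel : ∀ a b → (a -ℤ b) +ℤ b ≡ a
  sub-add-cancel = solve 2 (λ a b → (a :- b) :+ b := a) refl

cauchy-congʳ-≤ : ∀ A B B' n → (∀ i → i ≤ n → B i ≡ B' i) → cauchy A B n ≡ cauchy A B' n
cauchy-congʳ-≤ A B B' n e = sumTo-cong _ _ (suc n) (λ i p → cong (A i *ℤ_) (e (n ∸ i) (NP.m∸n≤m n i)))

⊛-cancelˡ-≤ : ∀ D Q1 Q2 → D 0 ≡ 1ℤ → D ⊛ Q1 ≈ D ⊛ Q2 → ∀ n i → i ≤ n → Q1 i ≡ Q2 i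
⊛-cancelˡ-≤ D Q1 Q2 d0 e zero .zero z≤n = begin
    Q1 0 ≡⟨ sym (ZP.+-identityʳ _) ⟩ Q1 0 +ℤ 0ℤ ≡⟨ cong (_+ℤ 0ℤ) (sym (trans (cong (_*ℤ Q1 0) d0) (ZP.*-identityˡ _))) ⟩
    D 0 *ℤ Q1 0 +ℤ 0ℤ ≡⟨ sym (⊛-cauchy D Q1 0) ⟩ (D ⊛ Q1) 0 ≡⟨ e 0 ⟩ (D ⊛ Q2) 0 ≡⟨ ⊛-cauchy D Q2 0 ⟩
    D 0 *ℤ Q2 0 +ℤ 0ℤ ≡⟨ cong (_+ℤ 0ℤ) (trans (cong (_*ℤ Q2 0) d0) (ZP.*-identityˡ _)) ⟩ Q2 0 +ℤ 0ℤ ≡⟨ ZP.+-identityʳ _ ⟩ Q2 0 ∎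
  where open Eq.≡-Reasoning
⊛-cancelˡ-≤ D Q1 Q2 d0 e (suc n) i i≤ with NP.m≤n⇒m<n∨m≡n i≤
... | inj₁ (s≤s i≤n) = ⊛-cancelˡ-≤ D Q1 Q2 d0 e n i i≤n
... | inj₂ refl = +ℤ-cancelʳ (cauchy (tailS D) Q2 n) _ _ (begin
    Q1 (suc n) +ℤ cauchy (tailS D) Q2 n ≡⟨ cong₂ _+ℤ_ (sym (trans (cong (_*ℤ Q1 (suc n)) d0) (ZP.*-identityˡ _))) (sym (cauchy-congʳ-≤ (tailS D) Q1 Q2 n (⊛-cancelˡ-≤ D Q1 Q2 d0 e n))) ⟩
    D 0 *ℤ Q1 (suc n) +ℤ cauchy (tailS D) Q1 n ≡⟨ sym (⊛-cauchy D Q1 (suc n)) ⟩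
    (D ⊛ Q1) (suc n) ≡⟨ e (suc n) ⟩
    (D ⊛ Q2) (suc n) ≡⟨ ⊛-cauchy D Q2 (suc n) ⟩
    D 0 *ℤ Q2 (suc n) +ℤ cauchy (tailS D) Q2 n ≡⟨ cong (_+ℤ cauchy (tailS D) Q2 n) (trans (cong (_*ℤ Q2 (suc n)) d0) (ZP.*-identityˡ _)) ⟩
    Q2 (suc n) +ℤ cauchy (tailS D) Q2 n ∎)
  where open Eq.≡-Reasoning

⊛-cancelˡ : ∀ D Q1 Q2 → D 0 ≡ 1ℤ → D ⊛ Q1 ≈ D ⊛ Q2 → Q1 ≈ Q2
⊛-cancelˡ D Q1 Q2 d0 e n = ⊛-cancelˡ-≤ D Q1 Q2 d0 e n n NP.≤-refl

zeroS≈constS0 : zeroS ≈ constS 0ℤ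
zeroS≈constS0 n = sym (ZP.*-zeroˡ (one n))

-- As R (suc k) = P k / P (suc k), it suffices that P (suc k) ⊛ G (suc k) ≈ P k, which
-- follows by induction from the recurrences of P and G.
module _ (G : ℕ → Series) (G₀≈0 : G 0 ≈ zeroS) (G-rec : ∀ k → G (suc k) ≈ one ⊕ X ⊛ (G k ⊛ G (suc k))) where

  P⊛G≈P : ∀ k → P (suc k) ⊛ G (suc k) ≈ P k
  P⊛G≈P zero = begin
      one ⊛ G 1 ≈⟨ ⊛-identityˡ (G 1) ⟩
      G 1 ≈⟨ G-rec 0 ⟩
      one ⊕ X ⊛ (G 0 ⊛ G 1) ≈⟨ ⊕-cong {one} (λ n → refl) (⊛-cong {X} (λ n → refl) (⊛-cong {B = G 1} {B' = G 1} (≈-trans G₀≈0 zeroS≈constS0) (λ n → refl))) ⟩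
      one ⊕ X ⊛ (constS 0ℤ ⊛ G 1) ≈⟨ solve 3 (λ o x g → o :+ x :* (con 0ℤ :* g) := o) (λ n → refl) one X (G 1) ⟩
      one ∎
    where
    open SeriesReasoning
    open SeriesSolver
  P⊛G≈P (suc k) = begin
      (P (suc k) ⊖ X ⊛ P k) ⊛ g
        ≈⟨ solve 6 (λ o p1 p0 x h g → (p1 :- x :* p0) :* g := p1 :* (g :- (o :+ x :* (h :* g))) :+ p1 :* o :+ x :* ((p1 :* h :- p0) :* g)) (λ n → refl) one (P (suc k)) (P k) X h g ⟩
      P (suc k) ⊛ (g ⊖ (one ⊕ X ⊛ (h ⊛ g))) ⊕ P (suc k) ⊛ one ⊕ X ⊛ ((P (suc k) ⊛ h ⊖ P k) ⊛ g)
        ≈⟨ ⊕-cong (⊕-cong (⊛-cong {P (suc k)} (λ n → refl) (≈-trans recurrence-gap zeroS≈constS0)) (λ n → refl)) (⊛-cong {X} (λ n → refl) (⊛-cong {B = g} {B' = g} (≈-trans induction-gap zeroS≈constS0) (λ n → refl))) ⟩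
      P (suc k) ⊛ constS 0ℤ ⊕ P (suc k) ⊛ one ⊕ X ⊛ (constS 0ℤ ⊛ g)
        ≈⟨ solve 4 (λ o p x g → p :* con 0ℤ :+ p :* o :+ x :* (con 0ℤ :* g) := p :* o) (λ n → refl) one (P (suc k)) X g ⟩
      P (suc k) ⊛ one ≈⟨ ≈-trans (⊛-comm (P (suc k)) one) (⊛-identityˡ (P (suc k))) ⟩
      P (suc k) ∎
    where
    open SeriesReasoning
    open SeriesSolver
    g h : Series
    g = G (suc (suc k))
    h = G (suc k)
    recurrence-gap : g ⊖ (one ⊕ X ⊛ (h ⊛ g)) ≈ zeroS
    recurrence-gap n = trans (cong (_-ℤ (one ⊕ X ⊛ (h ⊛ g)) n) (G-rec (suc k) n)) (ZP.+-inverseʳ ((one ⊕ X ⊛ (h ⊛ g)) n))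
    induction-gap : P (suc k) ⊛ h ⊖ P k ≈ zeroS
    induction-gap n = trans (cong (_-ℤ P k n) (P⊛G≈P k n)) (ZP.+-inverseʳ (P k n))

  recurrence⇒≈R : ∀ k → G k ≈ R k
  recurrence⇒≈R zero = G₀≈0
  recurrence⇒≈R (suc k) = ⊛-cancelˡ (P (suc k)) (G (suc k)) (R (suc k)) (P-coeff-zero (suc k))
    (≈-trans (P⊛G≈P k) (≈-sym (⊛-divS (P k) (P (suc k)) (P-coeff-zero (suc k)))))

-- Pattern containment

∧-true⁻ : ∀ {a b} → a ∧ b ≡ true → a ≡ true × b ≡ true
∧-true⁻ {true} {true} refl = refl , refl

∧-true⁺ : ∀ {a b} → a ≡ true → b ≡ true → a ∧ b ≡ true
∧-true⁺ refl refl = refl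

Bool-⇔⇒≡ : ∀ b c → (b ≡ true → c ≡ true) → (c ≡ true → b ≡ true) → b ≡ c
Bool-⇔⇒≡ true c f g = sym (f refl)
Bool-⇔⇒≡ false true f g = g refl
Bool-⇔⇒≡ false false f g = refl

anyB-sound : ∀ {A : Set} (p : A → Bool) l → anyB p l ≡ true → ∃[ x ] (x ∈ l × p x ≡ true)
anyB-sound p (x ∷ l) e with p x in eq
... | true = x , here refl , eq
... | false with anyB-sound p l e
... | y , m , q = y , there m , q

anyB-complete : ∀ {A : Set} (p : A → Bool) l x → x ∈ l → p x ≡ true → anyB p l ≡ true
anyB-complete p (y ∷ l) x (here refl) e rewrite e = refl
anyB-complete p (y ∷ l) x (there m) e with p y
... | true = refl
... | false = anyB-complete p l x m e

⊆-++⁻ : ∀ {s : List ℕ} u v → s ⊆ u ++ v → ∃[ s₁ ] ∃[ s₂ ] (s ≡ s₁ ++ s₂ × s₁ ⊆ u × s₂ ⊆ v)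
⊆-++⁻ [] v p = [] , _ , refl , [] , p
⊆-++⁻ (a ∷ u) v (.a ∷ʳ p) with ⊆-++⁻ u v p
... | s₁ , s₂ , refl , q₁ , q₂ = s₁ , s₂ , refl , a ∷ʳ q₁ , q₂
⊆-++⁻ (a ∷ u) v (refl ∷ p) with ⊆-++⁻ u v p
... | s₁ , s₂ , refl , q₁ , q₂ = a ∷ s₁ , s₂ , refl , refl ∷ q₁ , q₂

⊆-map⁻ : ∀ (f : ℕ → ℕ) {s} α → s ⊆ map f α → ∃[ s′ ] (s ≡ map f s′ × s′ ⊆ α)
⊆-map⁻ f [] [] = [] , refl , []
⊆-map⁻ f (a ∷ α) (.(f a) ∷ʳ p) with ⊆-map⁻ f α p
... | s′ , refl , q = s′ , refl , a ∷ʳ q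
⊆-map⁻ f (a ∷ α) (refl ∷ p) with ⊆-map⁻ f α p
... | s′ , refl , q = a ∷ s′ , refl , refl ∷ q

subseqs-sound : ∀ {s} α → s ∈ subseqs α → s ⊆ α
subseqs-sound [] (here refl) = []
subseqs-sound (a ∷ α) m with Mp.∈-++⁻ (map (a ∷_) (subseqs α)) m
... | inj₁ m₁ with Mp.∈-map⁻ (a ∷_) m₁
... | t , mt , refl = refl ∷ subseqs-sound α mt
subseqs-sound (a ∷ α) m | inj₂ m₂ = a ∷ʳ subseqs-sound α m₂

subseqs-complete : ∀ {s α : List ℕ} → s ⊆ α → s ∈ subseqs α
subseqs-complete [] = here refl
subseqs-complete (_∷ʳ_ {ys = α} a p) = Mp.∈-++⁺ʳ (map (a ∷_) (subseqs α)) (subseqs-complete p)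
subseqs-complete (refl ∷ p) = Mp.∈-++⁺ˡ (Mp.∈-map⁺ (_ ∷_) (subseqs-complete p))

Contains : List ℕ → List ℕ → Set
Contains α τ = ∃[ s ] (s ⊆ α × orderIso s τ ≡ true)

contains⇒Contains : ∀ α τ → contains α τ ≡ true → Contains α τ
contains⇒Contains α τ e with anyB-sound (λ s → orderIso s τ) (subseqs α) e
... | s , m , q = s , subseqs-sound α m , q

Contains⇒contains : ∀ α τ → Contains α τ → contains α τ ≡ true
Contains⇒contains α τ (s , p , q) = anyB-complete (λ s → orderIso s τ) (subseqs α) s (subseqs-complete p) q

Contains-mono : ∀ {α β τ} → α ⊆ β → Contains α τ → Contains β τ
Contains-mono p (s , q , r) = s , ⊆-trans q p , r

⌊≟⌋⇒≡ : ∀ c d → ⌊ c ≟B d ⌋ ≡ true → c ≡ d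
⌊≟⌋⇒≡ false false e = refl
⌊≟⌋⇒≡ true true e = refl

<⇒<ᵇ≡true : ∀ {m n} → m < n → (m <ᵇ n) ≡ true
<⇒<ᵇ≡true {m} {n} p with m <ᵇ n in eq
... | true = refl
... | false = ⊥-elim (subst T eq (NP.<⇒<ᵇ p))

≥⇒<ᵇ≡false : ∀ {m n} → n ≤ m → (m <ᵇ n) ≡ false
≥⇒<ᵇ≡false {m} {n} p with m <ᵇ n in eq
... | false = refl
... | true = ⊥-elim (NP.<⇒≱ (NP.<ᵇ⇒< m n (subst T (sym eq) _)) p)

<ᵇ≡true⇒< : ∀ {m n} → (m <ᵇ n) ≡ true → m < n
<ᵇ≡true⇒< {m} {n} e = NP.<ᵇ⇒< m n (subst T (sym e) _)

+-<ᵇ-cancelˡ : ∀ c a b → ((c + a) <ᵇ (c + b)) ≡ (a <ᵇ b)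
+-<ᵇ-cancelˡ zero a b = refl
+-<ᵇ-cancelˡ (suc c) a b = +-<ᵇ-cancelˡ c a b

orderIso⇒length≡ : ∀ s t → orderIso s t ≡ true → length s ≡ length t
orderIso⇒length≡ [] [] e = refl
orderIso⇒length≡ (a ∷ s) (b ∷ t) e = cong suc (orderIso⇒length≡ s t (proj₂ (∧-true⁻ {agree a s b t} e)))

agree-shiftˡ : ∀ c a as b bs → agree (c + a) (map (c +_) as) b bs ≡ agree a as b bs
agree-shiftˡ c a [] b [] = refl
agree-shiftˡ c a [] b (_ ∷ _) = refl
agree-shiftˡ c a (_ ∷ _) b [] = refl
agree-shiftˡ c a (x ∷ as) b (y ∷ bs) rewrite +-<ᵇ-cancelˡ c a x | +-<ᵇ-cancelˡ c x a | agree-shiftˡ c a as b bs = refl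

agree-shiftʳ : ∀ c b a as bs → agree a as (c + b) (map (c +_) bs) ≡ agree a as b bs
agree-shiftʳ c b a [] [] = refl
agree-shiftʳ c b a [] (_ ∷ _) = refl
agree-shiftʳ c b a (_ ∷ _) [] = refl
agree-shiftʳ c b a (x ∷ as) (y ∷ bs) rewrite +-<ᵇ-cancelˡ c b y | +-<ᵇ-cancelˡ c y b | agree-shiftʳ c b a as bs = refl

orderIso-shiftˡ : ∀ c s t → orderIso (map (c +_) s) t ≡ orderIso s t
orderIso-shiftˡ c [] [] = refl
orderIso-shiftˡ c [] (_ ∷ _) = refl
orderIso-shiftˡ c (_ ∷ _) [] = refl
orderIso-shiftˡ c (a ∷ s) (b ∷ t) rewrite agree-shiftˡ c a s b t | orderIso-shiftˡ c s t = refl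

orderIso-shiftʳ : ∀ c s t → orderIso s (map (c +_) t) ≡ orderIso s t
orderIso-shiftʳ c [] [] = refl
orderIso-shiftʳ c [] (_ ∷ _) = refl
orderIso-shiftʳ c (_ ∷ _) [] = refl
orderIso-shiftʳ c (a ∷ s) (b ∷ t) rewrite agree-shiftʳ c b a s t | orderIso-shiftʳ c s t = refl

-- The Bool selects the direction: Separated true xs ys puts xs above ys, false below.
Side : Bool → ℕ → ℕ → Set
Side true a x = x < a
Side false a x = a < x

Separated : Bool → List ℕ → List ℕ → Set
Separated o xs ys = All (λ a → All (Side o a) ys) xs

agree-Side : ∀ o a xs b ys → All (Side o a) xs → agree a xs b ys ≡ true → All (Side o b) ys
agree-Side o a [] b [] h e = []
agree-Side true a (x ∷ xs) b (y ∷ ys) (p ∷ h) e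
  rewrite ≥⇒<ᵇ≡false {a} {x} (NP.<⇒≤ p) | <⇒<ᵇ≡true p with ∧-true⁻ {⌊ true ≟B (y <ᵇ b) ⌋} (proj₂ (∧-true⁻ {⌊ false ≟B (b <ᵇ y) ⌋} e))
... | e1 , e2 = <ᵇ≡true⇒< (sym (⌊≟⌋⇒≡ true _ e1)) ∷ agree-Side true a xs b ys h e2
agree-Side false a (x ∷ xs) b (y ∷ ys) (p ∷ h) e
  rewrite ≥⇒<ᵇ≡false {x} {a} (NP.<⇒≤ p) | <⇒<ᵇ≡true p with ∧-true⁻ {⌊ true ≟B (b <ᵇ y) ⌋} e
... | e1 , e3 = <ᵇ≡true⇒< (sym (⌊≟⌋⇒≡ true _ e1)) ∷ agree-Side false a xs b ys h (proj₂ (∧-true⁻ {⌊ false ≟B (y <ᵇ b) ⌋} e3))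

Side⇒agree : ∀ o a xs b ys → All (Side o a) xs → All (Side o b) ys → length xs ≡ length ys → agree a xs b ys ≡ true
Side⇒agree o a [] b [] h g l = refl
Side⇒agree true a (x ∷ xs) b (y ∷ ys) (p ∷ h) (q ∷ g) l
  rewrite ≥⇒<ᵇ≡false {a} {x} (NP.<⇒≤ p) | <⇒<ᵇ≡true p | ≥⇒<ᵇ≡false {b} {y} (NP.<⇒≤ q) | <⇒<ᵇ≡true q = Side⇒agree true a xs b ys h g (NP.suc-injective l)
Side⇒agree false a (x ∷ xs) b (y ∷ ys) (p ∷ h) (q ∷ g) l
  rewrite ≥⇒<ᵇ≡false {x} {a} (NP.<⇒≤ p) | <⇒<ᵇ≡true p | ≥⇒<ᵇ≡false {y} {b} (NP.<⇒≤ q) | <⇒<ᵇ≡true q = Side⇒agree false a xs b ys h g (NP.suc-injective l)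

agree-++⁻ : ∀ a xs1 xs2 b ys1 ys2 → length xs1 ≡ length ys1 → agree a (xs1 ++ xs2) b (ys1 ++ ys2) ≡ true
  → agree a xs1 b ys1 ≡ true × agree a xs2 b ys2 ≡ true
agree-++⁻ a [] xs2 b [] ys2 l e = refl , e
agree-++⁻ a (x ∷ xs1) xs2 b (y ∷ ys1) ys2 l e
  with ∧-true⁻ {⌊ (a <ᵇ x) ≟B (b <ᵇ y) ⌋} e
... | e1 , e' with ∧-true⁻ {⌊ (x <ᵇ a) ≟B (y <ᵇ b) ⌋} e'
... | e2 , e3 with agree-++⁻ a xs1 xs2 b ys1 ys2 (NP.suc-injective l) e3
... | f1 , f2 = ∧-true⁺ e1 (∧-true⁺ e2 f1) , f2

agree-++⁺ : ∀ a xs1 xs2 b ys1 ys2 → agree a xs1 b ys1 ≡ true → agree a xs2 b ys2 ≡ true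
  → agree a (xs1 ++ xs2) b (ys1 ++ ys2) ≡ true
agree-++⁺ a [] xs2 b [] ys2 e1 e2 = e2
agree-++⁺ a (x ∷ xs1) xs2 b (y ∷ ys1) ys2 e1 e2
  with ∧-true⁻ {⌊ (a <ᵇ x) ≟B (b <ᵇ y) ⌋} e1
... | f1 , e' with ∧-true⁻ {⌊ (x <ᵇ a) ≟B (y <ᵇ b) ⌋} e'
... | f2 , f3 = ∧-true⁺ f1 (∧-true⁺ f2 (agree-++⁺ a xs1 xs2 b ys1 ys2 f3 e2))

orderIso-++⁻ : ∀ o s1 s2 t1 t2 → Separated o s1 s2 → length s1 ≡ length t1 → orderIso (s1 ++ s2) (t1 ++ t2) ≡ true
  → orderIso s1 t1 ≡ true × orderIso s2 t2 ≡ true × Separated o t1 t2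
orderIso-++⁻ o [] s2 [] t2 c l e = refl , e , []
orderIso-++⁻ o (a ∷ s1) s2 (b ∷ t1) t2 (ca ∷ c) l e with ∧-true⁻ {agree a (s1 ++ s2) b (t1 ++ t2)} e
... | e1 , e2 with agree-++⁻ a s1 s2 b t1 t2 (NP.suc-injective l) e1 | orderIso-++⁻ o s1 s2 t1 t2 c (NP.suc-injective l) e2
... | f1 , f2 | g1 , g2 , g3 = ∧-true⁺ f1 g1 , g2 , agree-Side o a s2 b t2 ca f2 ∷ g3

orderIso-++⁺ : ∀ o s1 s2 t1 t2 → Separated o s1 s2 → orderIso s1 t1 ≡ true → orderIso s2 t2 ≡ true → Separated o t1 t2
  → orderIso (s1 ++ s2) (t1 ++ t2) ≡ true
orderIso-++⁺ o [] s2 [] t2 c e1 e2 d = e2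
orderIso-++⁺ o (a ∷ s1) s2 (b ∷ t1) t2 (ca ∷ c) e1 e2 (db ∷ d) with ∧-true⁻ {agree a s1 b t1} e1
... | f1 , f2 = ∧-true⁺ (agree-++⁺ a s1 s2 b t1 t2 f1 (Side⇒agree o a s2 b t2 ca db (orderIso⇒length≡ s2 t2 e2)))
                        (orderIso-++⁺ o s1 s2 t1 t2 c f2 e2 d)

Separated-mono : ∀ {o s1 s2 u v} → s1 ⊆ u → s2 ⊆ v → Separated o u v → Separated o s1 s2
Separated-mono p q c = All.map (All-resp-⊆ q) (All-resp-⊆ p c)

Contains-++⁻ : ∀ o u v τ → Separated o u v → Contains (u ++ v) τ
  → ∃[ p ] (Contains u (take p τ) × Contains v (drop p τ) × Separated o (take p τ) (drop p τ))
Contains-++⁻ o u v τ c (s , sb , e) with ⊆-++⁻ u v sb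
... | s1 , s2 , refl , q1 , q2 = p , (s1 , q1 , proj₁ res) , (s2 , q2 , proj₁ (proj₂ res)) , proj₂ (proj₂ res)
  where
  p : ℕ
  p = length s1
  L : length s1 N.+ length s2 ≡ length τ
  L = trans (sym (Lp.length-++ s1)) (orderIso⇒length≡ (s1 ++ s2) τ e)
  lt : length (take p τ) ≡ p
  lt = trans (Lp.length-take p τ) (NP.m≤n⇒m⊓n≡m (subst (p ≤_) L (NP.m≤m+n p (length s2))))
  e' : orderIso (s1 ++ s2) (take p τ ++ drop p τ) ≡ true
  e' = subst (λ z → orderIso (s1 ++ s2) z ≡ true) (sym (Lp.take++drop≡id p τ)) e
  res : orderIso s1 (take p τ) ≡ true × orderIso s2 (drop p τ) ≡ true × Separated o (take p τ) (drop p τ)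
  res = orderIso-++⁻ o s1 s2 (take p τ) (drop p τ) (Separated-mono q1 q2 c) (sym lt) e'

Contains-++⁺ : ∀ o u v τ p → Separated o u v → Contains u (take p τ) → Contains v (drop p τ) → Separated o (take p τ) (drop p τ)
  → Contains (u ++ v) τ
Contains-++⁺ o u v τ p c (s1 , q1 , r1) (s2 , q2 , r2) d =
  s1 ++ s2 , ++⁺ q1 q2 ,
  subst (λ z → orderIso (s1 ++ s2) z ≡ true) (Lp.take++drop≡id p τ)
    (orderIso-++⁺ o s1 s2 (take p τ) (drop p τ) (Separated-mono q1 q2 c) r1 r2 d)

Contains-shiftˡ⁻ : ∀ c α τ → Contains (map (c +_) α) τ → Contains α τ
Contains-shiftˡ⁻ c α τ (s , p , e) with ⊆-map⁻ (c +_) α p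
... | s' , refl , q = s' , q , trans (sym (orderIso-shiftˡ c s' τ)) e

Contains-shiftˡ⁺ : ∀ c α τ → Contains α τ → Contains (map (c +_) α) τ
Contains-shiftˡ⁺ c α τ (s , p , e) = map (c +_) s , map⁺ (c +_) p , trans (orderIso-shiftˡ c s τ) e

Contains-shiftʳ⁻ : ∀ c α τ → Contains α (map (c +_) τ) → Contains α τ
Contains-shiftʳ⁻ c α τ (s , p , e) = s , p , trans (sym (orderIso-shiftʳ c s τ)) e

Contains-shiftʳ⁺ : ∀ c α τ → Contains α τ → Contains α (map (c +_) τ)
Contains-shiftʳ⁺ c α τ (s , p , e) = s , p , trans (orderIso-shiftʳ c s τ) e

Contains-[] : ∀ α → Contains α []
Contains-[] α = [] , minimum α , refl

Contains-[x]⁻ : ∀ N τ → Contains (N ∷ []) τ → length τ ≤ 1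
Contains-[x]⁻ N τ (s , p , e) = subst (_≤ 1) (orderIso⇒length≡ s τ e) (lenSub p)
  where
  lenSub : ∀ {s} → s ⊆ N ∷ [] → length s ≤ 1
  lenSub (_ ∷ʳ []) = z≤n
  lenSub (refl ∷ []) = s≤s z≤n

Contains-[x]⁺ : ∀ N τ → length τ ≤ 1 → Contains (N ∷ []) τ
Contains-[x]⁺ N [] _ = Contains-[] (N ∷ [])
Contains-[x]⁺ N (x ∷ []) _ = N ∷ [] , ⊆-refl , refl
Contains-[x]⁺ N (x ∷ y ∷ τ) (s≤s ())

agree-take : ∀ k a s b t → agree a s b t ≡ true → agree a (take k s) b (take k t) ≡ true
agree-take zero a s b t e with s | t
... | [] | [] = refl
... | [] | _ ∷ _ = refl
... | _ ∷ _ | [] = refl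
... | _ ∷ _ | _ ∷ _ = refl
agree-take (suc k) a [] b [] e = refl
agree-take (suc k) a (x ∷ s) b (y ∷ t) e
  with ∧-true⁻ {⌊ (a <ᵇ x) ≟B (b <ᵇ y) ⌋} e
... | f1 , e' with ∧-true⁻ {⌊ (x <ᵇ a) ≟B (y <ᵇ b) ⌋} e'
... | f2 , f3 = ∧-true⁺ f1 (∧-true⁺ f2 (agree-take k a s b t f3))

orderIso-take : ∀ k s t → orderIso s t ≡ true → orderIso (take k s) (take k t) ≡ true
orderIso-take zero s t e = refl
orderIso-take (suc k) [] [] e = refl
orderIso-take (suc k) (a ∷ s) (b ∷ t) e with ∧-true⁻ {agree a s b t} e
... | e1 , e2 = ∧-true⁺ (agree-take k a s b t e1) (orderIso-take k s t e2)

orderIso-drop : ∀ k s t → orderIso s t ≡ true → orderIso (drop k s) (drop k t) ≡ true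
orderIso-drop zero s t e = e
orderIso-drop (suc k) [] [] e = refl
orderIso-drop (suc k) (a ∷ s) (b ∷ t) e = orderIso-drop k s t (proj₂ (∧-true⁻ {agree a s b t} e))

Contains-take : ∀ k α τ → Contains α τ → Contains α (take k τ)
Contains-take k α τ (s , p , e) = take k s , ⊆-trans (take-⊆ k s) p , orderIso-take k s τ e

Contains-drop : ∀ k α τ → Contains α τ → Contains α (drop k τ)
Contains-drop k α τ (s , p , e) = drop k s , ⊆-trans (drop-⊆ k s) p , orderIso-drop k s τ e

Contains-∷ʳ-max⁻ : ∀ w N T → All (_< N) w → Contains (w ++ N ∷ []) T
  → Contains w T ⊎ ∃[ p ] (Contains w (take p T) × length (drop p T) ≡ 1 × Separated false (take p T) (drop p T))
Contains-∷ʳ-max⁻ w N T h c with Contains-++⁻ false w (N ∷ []) T (All.map (λ q → q ∷ []) h) c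
... | p , c1 , c2 , cr = go (drop p T) refl (Contains-[x]⁻ N (drop p T) c2)
  where
  go : ∀ L → drop p T ≡ L → length L ≤ 1
     → Contains w T ⊎ ∃[ p ] (Contains w (take p T) × length (drop p T) ≡ 1 × Separated false (take p T) (drop p T))
  go [] eqd _ = inj₁ (subst (Contains w) (trans (sym (Lp.++-identityʳ (take p T))) (trans (cong (take p T ++_) (sym eqd)) (Lp.take++drop≡id p T))) c1)
  go (x ∷ []) eqd _ = inj₂ (p , c1 , cong length eqd , cr)
  go (x ∷ y ∷ _) eqd (s≤s ())

Contains-∷ʳ⁺ : ∀ w N T → Contains w T → Contains (w ++ N ∷ []) T
Contains-∷ʳ⁺ w N T = Contains-mono (++⁺ʳ (N ∷ []) ⊆-refl)

Contains-∷ʳ-max⁺ : ∀ w N T p → All (_< N) w → Contains w (take p T) → length (drop p T) ≡ 1 → Separated false (take p T) (drop p T)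
  → Contains (w ++ N ∷ []) T
Contains-∷ʳ-max⁺ w N T p h c l cr = Contains-++⁺ false w (N ∷ []) T p (All.map (λ q → q ∷ []) h) c (Contains-[x]⁺ N (drop p T) (NP.≤-reflexive l)) cr

-- Layered patterns

run : ℕ → ℕ → List ℕ
run b zero = []
run b (suc d) = suc b ∷ run (suc b) d

applyUpTo-run : ∀ (h : ℕ → ℕ) b d → (∀ i → h i ≡ b + suc i) → applyUpTo h d ≡ run b d
applyUpTo-run h b zero e = refl
applyUpTo-run h b (suc d) e = cong₂ _∷_ (trans (e 0) (trans (NP.+-suc b 0) (cong suc (NP.+-identityʳ b))))
  (applyUpTo-run (h ∘ suc) (suc b) d (λ i → trans (e (suc i)) (NP.+-suc b (suc i))))

block-run : ∀ b a → block b a ≡ run b (a ∸ b)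
block-run b a = trans (Lp.map-applyUpTo id (λ i → b + suc i) (a ∸ b)) (applyUpTo-run _ b (a ∸ b) (λ i → refl))

length-run : ∀ b d → length (run b d) ≡ d
length-run b zero = refl
length-run b (suc d) = cong suc (length-run (suc b) d)

run-> : ∀ b d → All (b <_) (run b d)
run-> b zero = []
run-> b (suc d) = NP.≤-refl ∷ All.map (λ {x} p → NP.<-trans (NP.n<1+n b) p) (run-> (suc b) d)

run-≤ : ∀ b d → All (_≤ b + d) (run b d)
run-≤ b zero = []
run-≤ b (suc d) = NP.≤-trans (NP.m≤m+n (suc b) d) (NP.≤-reflexive (sym (NP.+-suc b d))) ∷
  All.map (λ p → NP.≤-trans p (NP.≤-reflexive (sym (NP.+-suc b d)))) (run-≤ (suc b) d)

map-+-run : ∀ c b d → map (c +_) (run b d) ≡ run (c + b) d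
map-+-run c b zero = refl
map-+-run c b (suc d) = cong₂ _∷_ (NP.+-suc c b) (trans (map-+-run c (suc b) d) (cong (λ z → run z d) (NP.+-suc c b)))

run-∷ʳ : ∀ b d → run b (suc d) ≡ run b d ++ (b + suc d) ∷ []
run-∷ʳ b zero = cong (_∷ []) (sym (trans (NP.+-suc b 0) (cong suc (NP.+-identityʳ b))))
run-∷ʳ b (suc d) = cong (suc b ∷_) (trans (run-∷ʳ (suc b) d) (cong (λ z → run (suc b) d ++ z ∷ []) (sym (NP.+-suc b (suc d)))))

take-length-++ : ∀ (xs ys : List ℕ) k → take (length xs + k) (xs ++ ys) ≡ xs ++ take k ys
take-length-++ [] ys k = refl
take-length-++ (x ∷ xs) ys k = cong (x ∷_) (take-length-++ xs ys k)

drop-length-++ : ∀ (xs ys : List ℕ) k → drop (length xs + k) (xs ++ ys) ≡ drop k ys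
drop-length-++ [] ys k = refl
drop-length-++ (x ∷ xs) ys k = drop-length-++ xs ys k

Separated-[]ʳ : ∀ o xs → Separated o xs []
Separated-[]ʳ o [] = []
Separated-[]ʳ o (x ∷ xs) = [] ∷ Separated-[]ʳ o xs

∸-split : ∀ {a b m} → m ≤ b → b ≤ a → a ∸ m ≡ (a ∸ b) + (b ∸ m)
∸-split {a} {b} {m} mb ba = trans (cong (_∸ m) (sym (NP.m∸n+n≡m ba))) (NP.+-∸-assoc (a ∸ b) mb)

Separated-run-cut : ∀ b d Z → All (_≤ b) Z → ∀ p → Separated true (take p (run b d ++ Z)) (drop p (run b d ++ Z))
  → p ≡ 0 ⊎ (d ≤ p × Separated true (take (p ∸ d) Z) (drop (p ∸ d) Z))
Separated-run-cut b zero Z hZ p cr = inj₂ (z≤n , cr)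
Separated-run-cut b (suc d) Z hZ zero cr = inj₁ refl
Separated-run-cut b (suc d) Z hZ (suc p) (h ∷ cr) with Separated-run-cut (suc b) d Z (All.map (λ q → NP.m≤n⇒m≤1+n q) hZ) p cr
... | inj₂ (dp , cr') = inj₂ (s≤s dp , cr')
... | inj₁ refl with d | h
...   | zero | _ = inj₂ (s≤s z≤n , [])
...   | suc d' | q ∷ _ = ⊥-elim (NP.<-irrefl refl (NP.<-trans (NP.n<1+n (suc b)) q))

data Decreasing : List ℕ → Set where
  last : ∀ {a} → 0 < a → Decreasing (a ∷ [])
  cons : ∀ {a b t} → b < a → Decreasing (b ∷ t) → Decreasing (a ∷ b ∷ t)

-- nth ms (length ms) = 0 plays the role of the paper's m_{r+1} = 0.
nth : List ℕ → ℕ → ℕ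
nth [] _ = 0
nth (x ∷ _) zero = x
nth (_ ∷ xs) (suc j) = nth xs j

nth-mono : ∀ {ms} → Decreasing ms → ∀ j → nth ms (suc j) ≤ nth ms j
nth-mono (last p) zero = z≤n
nth-mono (last p) (suc j) = z≤n
nth-mono (cons p d) zero = NP.<⇒≤ p
nth-mono (cons p d) (suc j) = nth-mono d j

nth-length : ∀ ms → nth ms (length ms) ≡ 0
nth-length [] = refl
nth-length (x ∷ ms) = nth-length ms

hd : List ℕ → ℕ
hd ms = nth ms 0

layered-∷ : ∀ a b t → layered (a ∷ b ∷ t) ≡ run b (a ∸ b) ++ layered (b ∷ t)
layered-∷ a b t = cong (_++ layered (b ∷ t)) (block-run b a)

layered-single : ∀ a → layered (a ∷ []) ≡ run 0 a
layered-single a = block-run 0 a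

hd>0 : ∀ {ms} → Decreasing ms → 0 < hd ms
hd>0 (last p) = p
hd>0 (cons p d) = NP.≤-trans (s≤s z≤n) p

nth≤hd : ∀ {ms} → Decreasing ms → ∀ j → nth ms j ≤ hd ms
nth≤hd (last p) zero = NP.≤-refl
nth≤hd (last p) (suc j) = z≤n
nth≤hd (cons p d) zero = NP.≤-refl
nth≤hd (cons p d) (suc j) = NP.≤-trans (nth≤hd d j) (NP.<⇒≤ p)

nth<hd : ∀ {ms} → Decreasing ms → ∀ j → 1 ≤ j → nth ms j < hd ms
nth<hd (last p) (suc j) _ = p
nth<hd (cons p d) (suc zero) _ = p
nth<hd (cons p d) (suc (suc j)) _ = NP.<-trans (nth<hd d (suc j) (s≤s z≤n)) p

length-layered : ∀ {ms} → Decreasing ms → length (layered ms) ≡ hd ms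
length-layered {a ∷ []} (last p) = trans (cong length (layered-single a)) (length-run 0 a)
length-layered {a ∷ b ∷ t} (cons p d) = trans (cong length (layered-∷ a b t))
  (trans (Lp.length-++ (run b (a ∸ b))) (trans (cong₂ _+_ (length-run b (a ∸ b)) (length-layered d)) (NP.m∸n+n≡m (NP.<⇒≤ p))))

layered≤hd : ∀ {ms} → Decreasing ms → All (_≤ hd ms) (layered ms)
layered≤hd {a ∷ []} (last p) = subst (All (_≤ a)) (sym (layered-single a)) (run-≤ 0 a)
layered≤hd {a ∷ b ∷ t} (cons p d) = subst (All (_≤ a)) (sym (layered-∷ a b t))
  (AllP.++⁺ (All.map (λ q → NP.≤-trans q (NP.≤-reflexive (NP.m+[n∸m]≡n (NP.<⇒≤ p)))) (run-≤ b (a ∸ b)))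
            (All.map (λ q → NP.≤-trans q (NP.<⇒≤ p)) (layered≤hd d)))

Separated-take-drop-all : ∀ o p τ → length τ ≤ p → Separated o (take p τ) (drop p τ)
Separated-take-drop-all o p τ l rewrite Lp.drop-all p τ l = Separated-[]ʳ o (take p τ)

take-layered-∷ : ∀ {a b t} → Decreasing (a ∷ b ∷ t) → ∀ j → take (a ∸ nth (b ∷ t) j) (layered (a ∷ b ∷ t)) ≡ run b (a ∸ b) ++ take (b ∸ nth (b ∷ t) j) (layered (b ∷ t))
take-layered-∷ {a} {b} {t} (cons p d) j rewrite layered-∷ a b t | ∸-split {a} {b} {nth (b ∷ t) j} (nth≤hd d j) (NP.<⇒≤ p) =
  trans (cong (λ z → take (z + (b ∸ nth (b ∷ t) j)) (run b (a ∸ b) ++ layered (b ∷ t))) (sym (length-run b (a ∸ b))))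
        (take-length-++ (run b (a ∸ b)) (layered (b ∷ t)) (b ∸ nth (b ∷ t) j))

drop-layered-∷ : ∀ {a b t} → Decreasing (a ∷ b ∷ t) → ∀ j → drop (a ∸ nth (b ∷ t) j) (layered (a ∷ b ∷ t)) ≡ drop (b ∸ nth (b ∷ t) j) (layered (b ∷ t))
drop-layered-∷ {a} {b} {t} (cons p d) j rewrite layered-∷ a b t | ∸-split {a} {b} {nth (b ∷ t) j} (nth≤hd d j) (NP.<⇒≤ p) =
  trans (cong (λ z → drop (z + (b ∸ nth (b ∷ t) j)) (run b (a ∸ b) ++ layered (b ∷ t))) (sym (length-run b (a ∸ b))))
        (drop-length-++ (run b (a ∸ b)) (layered (b ∷ t)) (b ∸ nth (b ∷ t) j))

layered-cut-Separated : ∀ {ms} → Decreasing ms → ∀ j → Separated true (take (hd ms ∸ nth ms j) (layered ms)) (drop (hd ms ∸ nth ms j) (layered ms))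
layered-cut-Separated {a ∷ t} d zero rewrite NP.n∸n≡0 a = []
layered-cut-Separated {a ∷ []} (last p) (suc j) = Separated-take-drop-all true a (layered (a ∷ [])) (NP.≤-reflexive (length-layered (last p)))
layered-cut-Separated {a ∷ b ∷ t} (cons p d) (suc j) rewrite take-layered-∷ (cons p d) j | drop-layered-∷ (cons p d) j =
  AllP.++⁺ (All.map (λ {x} bx → All.map (λ yb → NP.≤-<-trans yb bx) (AllP.drop⁺ (b ∸ nth (b ∷ t) j) (layered≤hd d))) (run-> b (a ∸ b)))
           (layered-cut-Separated d j)

Separated-layered-cut : ∀ {ms} → Decreasing ms → ∀ p → p ≤ hd ms → Separated true (take p (layered ms)) (drop p (layered ms))
  → ∃[ j ] (j ≤ length ms × p ≡ hd ms ∸ nth ms j)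
Separated-layered-cut {a ∷ []} (last q) p pa cr with Separated-run-cut 0 a [] [] p (subst (λ z → Separated true (take p z) (drop p z)) (trans (layered-single a) (sym (Lp.++-identityʳ (run 0 a)))) cr)
... | inj₁ refl = 0 , z≤n , sym (NP.n∸n≡0 a)
... | inj₂ (ap , _) = 1 , s≤s z≤n , NP.≤-antisym pa ap
Separated-layered-cut {a ∷ b ∷ t} (cons q d) p pa cr with Separated-run-cut b (a ∸ b) (layered (b ∷ t)) (layered≤hd d) p (subst (λ z → Separated true (take p z) (drop p z)) (layered-∷ a b t) cr)
... | inj₁ refl = 0 , z≤n , sym (NP.n∸n≡0 a)
... | inj₂ (abp , cr') with Separated-layered-cut d (p ∸ (a ∸ b)) pb cr'
  where
  pb : p ∸ (a ∸ b) ≤ b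
  pb = NP.≤-trans (NP.∸-monoˡ-≤ (a ∸ b) pa) (NP.≤-reflexive (NP.m∸[m∸n]≡n (NP.<⇒≤ q)))
...   | j , jl , e = suc j , s≤s jl , (begin
    p ≡⟨ sym (NP.m∸n+n≡m abp) ⟩
    p ∸ (a ∸ b) + (a ∸ b) ≡⟨ cong (_+ (a ∸ b)) e ⟩
    (b ∸ nth (b ∷ t) j) + (a ∸ b) ≡⟨ NP.+-comm (b ∸ nth (b ∷ t) j) (a ∸ b) ⟩
    (a ∸ b) + (b ∸ nth (b ∷ t) j) ≡⟨ sym (∸-split (nth≤hd d j) (NP.<⇒≤ q)) ⟩
    a ∸ nth (b ∷ t) j ∎)
  where open Eq.≡-Reasoning

take-first-layer : ∀ {ms} → Decreasing ms → take (hd ms ∸ nth ms 1) (layered ms) ≡ run (nth ms 1) (hd ms ∸ nth ms 1)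
take-first-layer {a ∷ []} (last p) = trans (cong (take a) (layered-single a)) (Lp.take-all a (run 0 a) (NP.≤-reflexive (length-run 0 a)))
take-first-layer {a ∷ b ∷ t} (cons p d) = trans (cong (take (a ∸ b)) (layered-∷ a b t))
  (trans (cong (λ z → take z (run b (a ∸ b) ++ layered (b ∷ t))) (sym (trans (NP.+-identityʳ _) (length-run b (a ∸ b)))))
  (trans (take-length-++ (run b (a ∸ b)) (layered (b ∷ t)) 0) (Lp.++-identityʳ _)))

-- When u lies below N, the entry N of u ++ N ∷ [] can only play the top of the first layer:
-- u ++ N ∷ [] contains the first hd ms ∸ nth ms j entries of τ iff u contains the first
-- prefixLength ms j of them.
prefixLength : List ℕ → ℕ → ℕ
prefixLength ms zero = 0
prefixLength ms (suc zero) = hd ms ∸ nth ms 1 ∸ 1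
prefixLength ms (suc (suc j)) = hd ms ∸ nth ms (suc (suc j))

m∸n≡1⇒n≡m∸1 : ∀ m p → m ∸ p ≡ 1 → p ≡ m ∸ 1
m∸n≡1⇒n≡m∸1 (suc zero) zero e = refl
m∸n≡1⇒n≡m∸1 (suc (suc m)) zero ()
m∸n≡1⇒n≡m∸1 (suc m) (suc p) e = trans (cong suc (m∸n≡1⇒n≡m∸1 m p e)) (suc[m∸1]≡m m p e)
  where
  suc[m∸1]≡m : ∀ m p → m ∸ p ≡ 1 → suc (m ∸ 1) ≡ m
  suc[m∸1]≡m (suc m) p e = refl
  suc[m∸1]≡m zero p e with () ← trans (sym (NP.0∸n≡0 p)) e

run-last-not-max : ∀ b e Z p → All (_≤ b) Z → 1 ≤ length Z → length (drop p (run b (suc e) ++ Z)) ≡ 1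
  → Separated false (take p (run b (suc e) ++ Z)) (drop p (run b (suc e) ++ Z)) → ⊥
run-last-not-max b e Z p hZ lZ l cr = contra
  where
  RR : List ℕ
  RR = run b (suc e)
  k : ℕ
  k = length Z ∸ 1
  pe : p ≡ length RR + k
  pe = trans (m∸n≡1⇒n≡m∸1 _ p (trans (sym (Lp.length-drop p (RR ++ Z))) l))
             (trans (cong (_∸ 1) (Lp.length-++ RR)) (NP.+-∸-assoc (length RR) lZ))
  cr' : Separated false (RR ++ take k Z) (drop k Z)
  cr' = Eq.subst₂ (Separated false) (trans (cong (λ z → take z (RR ++ Z)) pe) (take-length-++ RR Z k))
                               (trans (cong (λ z → drop z (RR ++ Z)) pe) (drop-length-++ RR Z k)) cr
  l' : length (drop k Z) ≡ 1
  l' = trans (cong length (sym (trans (cong (λ z → drop z (RR ++ Z)) pe) (drop-length-++ RR Z k)))) l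
  go : ∀ L → L ≡ drop k Z → length L ≡ 1 → All (suc b <_) L → All (_≤ b) L → ⊥
  go (z ∷ []) _ _ (q ∷ []) (q' ∷ []) = NP.<-irrefl refl (NP.<-≤-trans q (NP.≤-trans q' (NP.n≤1+n b)))
  contra : ⊥
  contra with cr'
  ... | h ∷ _ = go (drop k Z) refl l' h (AllP.drop⁺ k hZ)

suc[n∸m∸1]≡n∸m : ∀ {m n} → m < n → suc (n ∸ m ∸ 1) ≡ n ∸ m
suc[n∸m∸1]≡n∸m {m} {n} p with n ∸ m | NP.m<n⇒0<n∸m p
... | suc k | _ = refl

Contains-∷ʳ-max-run⁻ : ∀ w N m D τ → All (_< N) w → take (suc D) τ ≡ run m (suc D) → Contains (w ++ N ∷ []) (take (suc D) τ) → Contains w (take D τ)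
Contains-∷ʳ-max-run⁻ w N m D τ h eT c with Contains-∷ʳ-max⁻ w N (take (suc D) τ) h c
... | inj₁ c' = subst (Contains w) tt (Contains-take D w _ c')
  where
  tt : take D (take (suc D) τ) ≡ take D τ
  tt = trans (Lp.take-take D (suc D) τ) (cong (λ z → take z τ) (NP.m≤n⇒m⊓n≡m (NP.n≤1+n D)))
... | inj₂ (p , c' , l , _) = subst (Contains w) tt2 c'
  where
  tt : take D (take (suc D) τ) ≡ take D τ
  tt = trans (Lp.take-take D (suc D) τ) (cong (λ z → take z τ) (NP.m≤n⇒m⊓n≡m (NP.n≤1+n D)))
  lenT : length (take (suc D) τ) ≡ suc D
  lenT = trans (cong length eT) (length-run m (suc D))
  pe : p ≡ D
  pe = m∸n≡1⇒n≡m∸1 (suc D) p (trans (sym (cong (_∸ p) lenT)) (trans (sym (Lp.length-drop p (take (suc D) τ))) l))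
  tt2 : take p (take (suc D) τ) ≡ take D τ
  tt2 = trans (cong (λ z → take z (take (suc D) τ)) pe) tt

Contains-∷ʳ-max-run⁺ : ∀ w N m D τ → All (_< N) w → take (suc D) τ ≡ run m (suc D) → Contains w (take D τ) → Contains (w ++ N ∷ []) (take (suc D) τ)
Contains-∷ʳ-max-run⁺ w N m D τ h eT c = Contains-∷ʳ-max⁺ w N TT D h c' l cr
  where
  TT : List ℕ
  TT = take (suc D) τ
  tt : take D TT ≡ take D τ
  tt = trans (Lp.take-take D (suc D) τ) (cong (λ z → take z τ) (NP.m≤n⇒m⊓n≡m (NP.n≤1+n D)))
  c' : Contains w (take D TT)
  c' = subst (Contains w) (sym tt) c
  eT' : TT ≡ run m D ++ (m + suc D) ∷ []
  eT' = trans eT (run-∷ʳ m D)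
  tk : take D TT ≡ run m D
  tk = trans (cong (take D) eT') (trans (cong (λ z → take z (run m D ++ (m + suc D) ∷ [])) (sym (trans (NP.+-identityʳ _) (length-run m D))))
         (trans (take-length-++ (run m D) _ 0) (Lp.++-identityʳ _)))
  dk : drop D TT ≡ (m + suc D) ∷ []
  dk = trans (cong (drop D) eT') (trans (cong (λ z → drop z (run m D ++ (m + suc D) ∷ [])) (sym (trans (NP.+-identityʳ _) (length-run m D))))
         (drop-length-++ (run m D) _ 0))
  l : length (drop D TT) ≡ 1
  l = cong length dk
  cr : Separated false (take D TT) (drop D TT)
  cr = Eq.subst₂ (Separated false) (sym tk) (sym dk)
         (All.map (λ q → (NP.≤-<-trans q (NP.+-monoʳ-< m (NP.n<1+n D))) ∷ []) (run-≤ m D))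

length-take-layered-positive : ∀ {b t} → Decreasing (b ∷ t) → ∀ k → 1 ≤ k → k ≤ b → 1 ≤ length (take k (layered (b ∷ t)))
length-take-layered-positive {b} {t} d k k1 kb = subst (1 ≤_) (sym (trans (Lp.length-take k _) (trans (cong (k N.⊓_) (length-layered d)) (NP.m≤n⇒m⊓n≡m kb)))) k1

Contains-∷ʳ-max-prefix⁻ : ∀ {ms} → Decreasing ms → ∀ w N → All (_< N) w → ∀ j → j ≤ length ms
  → Contains (w ++ N ∷ []) (take (hd ms ∸ nth ms j) (layered ms)) → Contains w (take (prefixLength ms j) (layered ms))
Contains-∷ʳ-max-prefix⁻ {ms} d w N h zero _ c = Contains-[] w
Contains-∷ʳ-max-prefix⁻ {ms} d w N h (suc zero) _ c =
  Contains-∷ʳ-max-run⁻ w N (nth ms 1) (hd ms ∸ nth ms 1 ∸ 1) (layered ms) h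
      (trans (cong (λ z → take z (layered ms)) sp) (trans (take-first-layer d) (cong (run (nth ms 1)) (sym sp))))
      (subst (λ z → Contains (w ++ N ∷ []) (take z (layered ms))) (sym sp) c)
  where
  sp : suc (hd ms ∸ nth ms 1 ∸ 1) ≡ hd ms ∸ nth ms 1
  sp = suc[n∸m∸1]≡n∸m (nth<hd d 1 (s≤s z≤n))
Contains-∷ʳ-max-prefix⁻ {a ∷ []} (last x) w N h (suc (suc j)) (s≤s ()) c
Contains-∷ʳ-max-prefix⁻ {a ∷ b ∷ t} (cons p d) w N h (suc (suc j)) jl c with Contains-∷ʳ-max⁻ w N _ h c
... | inj₁ c' = c'
... | inj₂ (q , _ , l , cr) = ⊥-elim (run-last-not-max b e Z q (AllP.take⁺ k (layered≤hd d)) (length-take-layered-positive d k k1 kb) l' cr')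
  where
  m k : ℕ
  m = nth (b ∷ t) (suc j)
  k = b ∸ m
  Z : List ℕ
  Z = take k (layered (b ∷ t))
  k1 : 1 ≤ k
  k1 = NP.m<n⇒0<n∸m (nth<hd d (suc j) (s≤s z≤n))
  kb : k ≤ b
  kb = NP.m∸n≤m b m
  e : ℕ
  e = a ∸ b ∸ 1
  eq : take (a ∸ m) (layered (a ∷ b ∷ t)) ≡ run b (suc e) ++ Z
  eq = trans (take-layered-∷ (cons p d) (suc j)) (cong (λ z → run b z ++ Z) (sym (suc[n∸m∸1]≡n∸m p)))
  l' : length (drop q (run b (suc e) ++ Z)) ≡ 1
  l' = subst (λ z → length (drop q z) ≡ 1) eq l
  cr' : Separated false (take q (run b (suc e) ++ Z)) (drop q (run b (suc e) ++ Z))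
  cr' = subst (λ z → Separated false (take q z) (drop q z)) eq cr

Contains-∷ʳ-max-prefix⁺ : ∀ {ms} → Decreasing ms → ∀ w N → All (_< N) w → ∀ j → j ≤ length ms
  → Contains w (take (prefixLength ms j) (layered ms)) → Contains (w ++ N ∷ []) (take (hd ms ∸ nth ms j) (layered ms))
Contains-∷ʳ-max-prefix⁺ {ms} d w N h zero _ c rewrite NP.n∸n≡0 (hd ms) = Contains-[] _
Contains-∷ʳ-max-prefix⁺ {ms} d w N h (suc zero) _ c =
  subst (λ z → Contains (w ++ N ∷ []) (take z (layered ms))) sp
  (Contains-∷ʳ-max-run⁺ w N (nth ms 1) (hd ms ∸ nth ms 1 ∸ 1) (layered ms) h
      (trans (cong (λ z → take z (layered ms)) sp) (trans (take-first-layer d) (cong (run (nth ms 1)) (sym sp)))) c)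
  where
  sp : suc (hd ms ∸ nth ms 1 ∸ 1) ≡ hd ms ∸ nth ms 1
  sp = suc[n∸m∸1]≡n∸m (nth<hd d 1 (s≤s z≤n))
Contains-∷ʳ-max-prefix⁺ {a ∷ []} (last x) w N h (suc (suc j)) (s≤s ()) c
Contains-∷ʳ-max-prefix⁺ {a ∷ b ∷ t} (cons p d) w N h (suc (suc j)) jl c = Contains-∷ʳ⁺ w N _ c

take-layered-shape : ∀ {ms} → Decreasing ms → ∀ j → 1 ≤ j → suc j ≤ length ms
  → take (hd ms ∸ nth ms j) (layered ms) ≡ map (nth ms j +_) (layered (map (_∸ nth ms j) (take j ms)))
take-layered-shape {a ∷ []} (last x) (suc j) _ (s≤s ())
take-layered-shape {a ∷ b ∷ t} (cons p d) (suc zero) _ _ =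
  trans (take-first-layer (cons p d)) (sym (trans (cong (map (b +_)) (layered-single (a ∸ b))) (trans (map-+-run b 0 (a ∸ b)) (cong (λ z → run z (a ∸ b)) (NP.+-identityʳ b)))))
take-layered-shape {a ∷ b ∷ t} (cons p d) (suc (suc j)) _ (s≤s jl) =
  begin
    take (a ∸ m) (layered (a ∷ b ∷ t))
  ≡⟨ take-layered-∷ (cons p d) (suc j) ⟩
    run b (a ∸ b) ++ take (b ∸ m) (layered (b ∷ t))
  ≡⟨ cong₂ _++_ (sym (trans (map-+-run m (b ∸ m) _) (cong₂ run (NP.m+[n∸m]≡n mb) dd))) (take-layered-shape d (suc j) (s≤s z≤n) jl) ⟩
    map (m +_) (run (b ∸ m) ((a ∸ m) ∸ (b ∸ m))) ++ map (m +_) (layered (map (_∸ m) (take (suc j) (b ∷ t))))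
  ≡⟨ sym (Lp.map-++ (m +_) (run (b ∸ m) ((a ∸ m) ∸ (b ∸ m))) _) ⟩
    map (m +_) (run (b ∸ m) ((a ∸ m) ∸ (b ∸ m)) ++ layered (map (_∸ m) (take (suc j) (b ∷ t))))
  ≡⟨ cong (map (m +_)) (sym (layered-∷ (a ∸ m) (b ∸ m) (map (_∸ m) (take j t)))) ⟩
    map (m +_) (layered (map (_∸ m) (take (suc (suc j)) (a ∷ b ∷ t))))
  ∎
  where
  open Eq.≡-Reasoning
  m : ℕ
  m = nth (b ∷ t) (suc j)
  mb : m ≤ b
  mb = nth≤hd d (suc j)
  dd : (a ∸ m) ∸ (b ∸ m) ≡ a ∸ b
  dd = trans (cong (_∸ (b ∸ m)) (∸-split mb (NP.<⇒≤ p))) (NP.m+n∸n≡m (a ∸ b) (b ∸ m))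

drop-layered-shape : ∀ {ms} → Decreasing ms → ∀ j → j ≤ length ms → drop (hd ms ∸ nth ms j) (layered ms) ≡ layered (drop j ms)
drop-layered-shape {a ∷ t} d zero _ rewrite NP.n∸n≡0 a = refl
drop-layered-shape {a ∷ []} (last x) (suc zero) _ = Lp.drop-all a (layered (a ∷ [])) (NP.≤-reflexive (length-layered (last x)))
drop-layered-shape {a ∷ []} (last x) (suc (suc j)) (s≤s ())
drop-layered-shape {a ∷ b ∷ t} (cons p d) (suc j) (s≤s jl) = trans (drop-layered-∷ (cons p d) j) (drop-layered-shape d j jl)

-- Enumerating permutations

iota : ℕ → List ℕ
iota zero = []
iota (suc n) = iota n ++ suc n ∷ []

iota-+ : ∀ c k → iota (c + k) ≡ iota c ++ map (c +_) (iota k)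
iota-+ c zero = trans (cong iota (NP.+-identityʳ c)) (sym (Lp.++-identityʳ (iota c)))
iota-+ c (suc k) = begin
    iota (c + suc k) ≡⟨ cong iota (NP.+-suc c k) ⟩
    iota (c + k) ++ suc (c + k) ∷ [] ≡⟨ cong (_++ suc (c + k) ∷ []) (iota-+ c k) ⟩
    (iota c ++ map (c +_) (iota k)) ++ suc (c + k) ∷ [] ≡⟨ Lp.++-assoc (iota c) _ _ ⟩
    iota c ++ (map (c +_) (iota k) ++ suc (c + k) ∷ []) ≡⟨ cong (iota c ++_) (cong (map (c +_) (iota k) ++_) (cong (_∷ []) (sym (NP.+-suc c k)))) ⟩
    iota c ++ (map (c +_) (iota k) ++ map (c +_) (suc k ∷ [])) ≡⟨ cong (iota c ++_) (sym (Lp.map-++ (c +_) (iota k) (suc k ∷ []))) ⟩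
    iota c ++ map (c +_) (iota (suc k)) ∎
  where open Eq.≡-Reasoning

iota-bounds : ∀ n → All (λ x → 0 < x × x ≤ n) (iota n)
iota-bounds zero = []
iota-bounds (suc n) = AllP.++⁺ (All.map (λ (p , q) → p , NP.m≤n⇒m≤1+n q) (iota-bounds n)) ((s≤s z≤n , NP.≤-refl) ∷ [])

Unique-resp-↭ : ∀ {A : Set} {xs ys : List A} → xs ↭ ys → Unique xs → Unique ys
Unique-resp-↭ p = PermSetoid.Unique-resp-↭ (Eq.setoid _) (↭⇒↭ₛ p)

iota-unique : ∀ n → Unique (iota n)
iota-unique zero = []
iota-unique (suc n) = UP.++⁺ (iota-unique n) ([] ∷ []) disj
  where
  disj : ∀ {v} → v ∈ iota n × v ∈ suc n ∷ [] → ⊥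
  disj (m , here refl) = NP.<-irrefl refl (proj₂ (All.lookup (iota-bounds n) m))

inserts-↭ : ∀ a β {α} → α ∈ inserts a β → α ↭ a ∷ β
inserts-↭ a [] (here refl) = prefl
inserts-↭ a (b ∷ β) (here refl) = prefl
inserts-↭ a (b ∷ β) (there m) with Mp.∈-map⁻ (b ∷_) m
... | α' , m' , refl = ptrans (prep b (inserts-↭ a β m')) (swap b a prefl)

∈-inserts : ∀ a xs ys → xs ++ a ∷ ys ∈ inserts a (xs ++ ys)
∈-inserts a [] [] = here refl
∈-inserts a [] (y ∷ ys) = here refl
∈-inserts a (x ∷ xs) ys = there (Mp.∈-map⁺ (x ∷_) (∈-inserts a xs ys))

perms-sound : ∀ n {α} → α ∈ perms n → α ↭ iota n
perms-sound zero (here refl) = prefl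
perms-sound (suc n) {α} m with Mp.∈-concat⁻′ (L.map (inserts (suc n)) (perms n)) m
... | l , m1 , m2 with Mp.∈-map⁻ (inserts (suc n)) m2
... | β , mβ , refl = ptrans (inserts-↭ (suc n) β m1) (ptrans (prep (suc n) (perms-sound n mβ))
      (ptrans (↭-reflexive (cong (suc n ∷_) (sym (Lp.++-identityʳ (iota n))))) (↭-sym (PP.shift (suc n) (iota n) []))))

perms-complete : ∀ n {α} → α ↭ iota n → α ∈ perms n
perms-complete zero p rewrite PP.↭-empty-inv p = here refl
perms-complete (suc n) {α} p with Mp.∈-∃++ (PP.∈-resp-↭ (↭-sym p) (Mp.∈-++⁺ʳ (iota n) (here refl)))
... | xs , ys , refl = Mp.∈-concat⁺′ (∈-inserts (suc n) xs ys) (Mp.∈-map⁺ (inserts (suc n)) (perms-complete n q))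
  where
  q : xs ++ ys ↭ iota n
  q = ptrans (PP.drop-mid xs (iota n) {zs = []} p) (↭-reflexive (Lp.++-identityʳ _))

Unique-concatMap : ∀ {A B : Set} (f : A → List B) (key : B → A) xs → Unique xs → (∀ x → x ∈ xs → Unique (f x))
  → (∀ x z → x ∈ xs → z ∈ f x → key z ≡ x) → Unique (L.concatMap f xs)
Unique-concatMap f key [] u uf k = []
Unique-concatMap f key (x ∷ xs) (hx ∷ u) uf k = UP.++⁺ (uf x (here refl)) (Unique-concatMap f key xs u (λ y m → uf y (there m)) (λ y z m → k y z (there m))) disj
  where
  disj : ∀ {v} → v ∈ f x × v ∈ L.concatMap f xs → ⊥
  disj {v} (m1 , m2) with Mp.∈-concat⁻′ (L.map f xs) m2
  ... | l , m3 , m4 with Mp.∈-map⁻ f m4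
  ... | y , my , refl = All.lookup hx my (trans (sym (k x v (here refl) m1)) (k y v (there my) m3))

remove : ℕ → List ℕ → List ℕ
remove a [] = []
remove a (x ∷ xs) = if x N.≡ᵇ a then xs else x ∷ remove a xs

remove-++-∷ : ∀ a xs ys → All (_≢ a) xs → remove a (xs ++ a ∷ ys) ≡ xs ++ ys
remove-++-∷ a [] ys [] with a N.≡ᵇ a in eq
... | true = refl
... | false = ⊥-elim (subst T eq (NP.≡⇒≡ᵇ a a refl))
remove-++-∷ a (x ∷ xs) ys (h ∷ hs) with x N.≡ᵇ a in eq
... | true = ⊥-elim (h (NP.≡ᵇ⇒≡ x a (subst T (sym eq) _)))
... | false = cong (x ∷_) (remove-++-∷ a xs ys hs)

inserts-shape : ∀ a β {α} → α ∈ inserts a β → ∃[ xs ] ∃[ ys ] (β ≡ xs ++ ys × α ≡ xs ++ a ∷ ys)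
inserts-shape a [] (here refl) = [] , [] , refl , refl
inserts-shape a (b ∷ β) (here refl) = [] , b ∷ β , refl , refl
inserts-shape a (b ∷ β) (there m) with Mp.∈-map⁻ (b ∷_) m
... | α' , m' , refl with inserts-shape a β m'
... | xs , ys , refl , refl = b ∷ xs , ys , refl , refl

∉⇒All≢ : ∀ {a : ℕ} xs → ¬ (a ∈ xs) → All (_≢ a) xs
∉⇒All≢ [] n = []
∉⇒All≢ (x ∷ xs) n = (λ e → n (here (sym e))) ∷ ∉⇒All≢ xs (λ m → n (there m))

remove-inserts : ∀ a β {α} → ¬ (a ∈ β) → α ∈ inserts a β → remove a α ≡ β
remove-inserts a β n m with inserts-shape a β m
... | xs , ys , refl , refl = remove-++-∷ a xs ys (∉⇒All≢ xs (λ q → n (Mp.∈-++⁺ˡ {ys = ys} q)))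

inserts-unique : ∀ a β → ¬ (a ∈ β) → Unique (inserts a β)
inserts-unique a [] n = [] ∷ []
inserts-unique a (b ∷ β) n = All.tabulate hd≢ ∷ UP.map⁺ (λ e → Lp.∷-injectiveʳ e) (inserts-unique a β (λ m → n (there m)))
  where
  hd≢ : ∀ {z} → z ∈ L.map (b ∷_) (inserts a β) → a ∷ b ∷ β ≢ z
  hd≢ m e with Mp.∈-map⁻ (b ∷_) m
  ... | z' , _ , refl = n (here (Lp.∷-injectiveˡ e))

perms-unique : ∀ n → Unique (perms n)
perms-unique zero = [] ∷ []
perms-unique (suc n) = Unique-concatMap (inserts (suc n)) (remove (suc n)) (perms n) (perms-unique n)
  (λ β m → inserts-unique (suc n) β (notin β m))
  (λ β z m mz → remove-inserts (suc n) β (notin β m) mz)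
  where
  notin : ∀ β → β ∈ perms n → ¬ (suc n ∈ β)
  notin β m q = NP.<-irrefl refl (proj₂ (All.lookup (PP.All-resp-↭ (↭-sym (perms-sound n m)) (iota-bounds n)) q))

-- Decomposing 132-avoiders at their maximum

filterB : (List ℕ → Bool) → List (List ℕ) → List (List ℕ)
filterB p [] = []
filterB p (x ∷ xs) = if p x then x ∷ filterB p xs else filterB p xs

∈-filterB⁻ : ∀ p l {α} → α ∈ filterB p l → α ∈ l × p α ≡ true
∈-filterB⁻ p (x ∷ l) m with p x in eq
∈-filterB⁻ p (x ∷ l) (here refl) | true = here refl , eq
∈-filterB⁻ p (x ∷ l) (there m) | true = there (proj₁ (∈-filterB⁻ p l m)) , proj₂ (∈-filterB⁻ p l m)
∈-filterB⁻ p (x ∷ l) m | false = there (proj₁ (∈-filterB⁻ p l m)) , proj₂ (∈-filterB⁻ p l m)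

∈-filterB⁺ : ∀ p l {α} → α ∈ l → p α ≡ true → α ∈ filterB p l
∈-filterB⁺ p (x ∷ l) (here refl) e rewrite e = here refl
∈-filterB⁺ p (x ∷ l) (there m) e with p x
... | true = there (∈-filterB⁺ p l m e)
... | false = ∈-filterB⁺ p l m e

filterB-unique : ∀ p l → Unique l → Unique (filterB p l)
filterB-unique p [] u = []
filterB-unique p (x ∷ l) (h ∷ u) with p x
... | true = All.tabulate (λ m → All.lookup h (proj₁ (∈-filterB⁻ p l m))) ∷ filterB-unique p l u
... | false = filterB-unique p l u

av132 : List ℕ → Bool
av132 α = avoids α p132

Av132 : ℕ → List (List ℕ)
Av132 n = filterB av132 (perms n)

avoids⇒¬Contains : ∀ α τ → avoids α τ ≡ true → Contains α τ → ⊥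
avoids⇒¬Contains α τ e c with contains α τ | Contains⇒contains α τ c
avoids⇒¬Contains α τ () c | true | _

¬Contains⇒avoids : ∀ α τ → (Contains α τ → ⊥) → avoids α τ ≡ true
¬Contains⇒avoids α τ n with contains α τ in eq
... | true = ⊥-elim (n (contains⇒Contains α τ eq))
... | false = refl

record IsAv132 (n : ℕ) (α : List ℕ) : Set where
  field
    perm : α ↭ iota n
    av : Contains α p132 → ⊥

∈Av132⇒IsAv132 : ∀ n {α} → α ∈ Av132 n → IsAv132 n α
∈Av132⇒IsAv132 n {α} m with ∈-filterB⁻ av132 (perms n) m
... | m1 , e = record { perm = perms-sound n m1 ; av = avoids⇒¬Contains α p132 e }

IsAv132⇒∈Av132 : ∀ n {α} → IsAv132 n α → α ∈ Av132 n
IsAv132⇒∈Av132 n {α} h = ∈-filterB⁺ av132 (perms n) (perms-complete n (IsAv132.perm h)) (¬Contains⇒avoids α p132 (IsAv132.av h))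

IsAv132-bounds : ∀ {n α} → IsAv132 n α → All (λ x → 0 < x × x ≤ n) α
IsAv132-bounds h = PP.All-resp-↭ (↭-sym (IsAv132.perm h)) (iota-bounds _)

length-iota : ∀ n → length (iota n) ≡ n
length-iota zero = refl
length-iota (suc n) = trans (Lp.length-++ (iota n)) (trans (NP.+-comm (length (iota n)) 1) (cong suc (length-iota n)))

IsAv132-length : ∀ {n α} → IsAv132 n α → length α ≡ n
IsAv132-length {n} h = trans (PP.↭-length (IsAv132.perm h)) (length-iota n)

glue : ℕ → ℕ → List ℕ → List ℕ → List ℕ
glue n i β γ = map ((n ∸ i) +_) β ++ suc n ∷ γ

glue-avoids-132 : ∀ w N γ → All (_< N) w → Separated true (w ++ N ∷ []) γ → (Contains w p132 → ⊥) → (Contains γ p132 → ⊥)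
  → Contains ((w ++ N ∷ []) ++ γ) p132 → ⊥
glue-avoids-132 w N γ hw cr nw nγ c with Contains-++⁻ true (w ++ N ∷ []) γ p132 cr c
... | zero , _ , c2 , _ = nγ c2
... | suc zero , _ , _ , ((s≤s () ∷ _) ∷ _)
... | suc (suc zero) , _ , _ , ((s≤s () ∷ []) ∷ _)
... | suc (suc (suc p)) , c1 , _ , _ with Contains-∷ʳ-max⁻ w N p132 hw (subst (λ z → Contains (w ++ N ∷ []) (1 ∷ 3 ∷ 2 ∷ z)) (Lp.take-[] p) c1)
...   | inj₁ c' = nw c'
...   | inj₂ (zero , _ , () , _)
...   | inj₂ (suc zero , _ , () , _)
...   | inj₂ (suc (suc zero) , _ , _ , (_ ∷ (s≤s (s≤s ()) ∷ []) ∷ []))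
...   | inj₂ (suc (suc (suc q)) , _ , l , _) with () ← trans (sym (cong length (Lp.drop-[] q))) l

glue-<max : ∀ {n i β} → i ≤ n → IsAv132 i β → All (_< suc n) (map ((n ∸ i) +_) β)
glue-<max {n} {i} i≤n hβ = AllP.map⁺ (All.map (λ {x} (_ , x≤i) → s≤s (subst ((n ∸ i) + x ≤_) (NP.m∸n+n≡m i≤n) (NP.+-monoʳ-≤ (n ∸ i) x≤i))) (IsAv132-bounds hβ))

glue-Separated : ∀ {n i β γ} → i ≤ n → IsAv132 i β → IsAv132 (n ∸ i) γ → Separated true (map ((n ∸ i) +_) β ++ suc n ∷ []) γ
glue-Separated {n} {i} {γ = γ} i≤n hβ hγ =
  AllP.++⁺ (AllP.map⁺ (All.map (λ {x} (0<x , _) → All.map (λ y≤c → NP.≤-<-trans y≤c (NP.m<m+n (n ∸ i) 0<x)) γ≤c) (IsAv132-bounds hβ)))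
           (All.map (λ y≤c → s≤s (NP.≤-trans y≤c (NP.m∸n≤m n i))) γ≤c ∷ [])
  where
  γ≤c : All (_≤ n ∸ i) γ
  γ≤c = All.map proj₂ (IsAv132-bounds hγ)

glue∈Av132 : ∀ n i → i ≤ n → ∀ {β γ} → β ∈ Av132 i → γ ∈ Av132 (n ∸ i) → glue n i β γ ∈ Av132 (suc n)
glue∈Av132 n i i≤n {β} {γ} mβ mγ = IsAv132⇒∈Av132 (suc n) (record { perm = PM ; av = AV })
  where
  c : ℕ
  c = n ∸ i
  hβ : IsAv132 i β
  hβ = ∈Av132⇒IsAv132 i mβ
  hγ : IsAv132 c γ
  hγ = ∈Av132⇒IsAv132 c mγ
  cn : c + i ≡ n
  cn = NP.m∸n+n≡m i≤n
  w : List ℕ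
  w = map (c +_) β
  P1 : w ++ γ ↭ iota n
  P1 = ptrans (PP.++⁺ (PP.map⁺ (c +_) (IsAv132.perm hβ)) (IsAv132.perm hγ))
        (ptrans (PP.++-comm (map (c +_) (iota i)) (iota c)) (↭-reflexive (trans (sym (iota-+ c i)) (cong iota cn))))
  PM : glue n i β γ ↭ iota (suc n)
  PM = ptrans (PP.shift (suc n) w γ) (ptrans (prep (suc n) P1)
        (ptrans (↭-reflexive (cong (suc n ∷_) (sym (Lp.++-identityʳ (iota n))))) (↭-sym (PP.shift (suc n) (iota n) []))))
  AV : Contains (glue n i β γ) p132 → ⊥
  AV c′ = glue-avoids-132 w (suc n) γ (glue-<max i≤n hβ) (glue-Separated i≤n hβ hγ)
            (λ q → IsAv132.av hβ (Contains-shiftˡ⁻ c β p132 q)) (IsAv132.av hγ)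
            (subst (λ z → Contains z p132) (sym (Lp.++-assoc w (suc n ∷ []) γ)) c′)

glued : ℕ → List (List ℕ)
glued n = L.concatMap (λ i → L.concatMap (λ β → L.map (glue n i β) (Av132 (n ∸ i))) (Av132 i)) (upTo (suc n))

glue∈glued : ∀ n i → i ≤ n → ∀ {β γ} → β ∈ Av132 i → γ ∈ Av132 (n ∸ i) → glue n i β γ ∈ glued n
glue∈glued n i i≤n {β} {γ} mβ mγ =
  Mp.∈-concat⁺′ (Mp.∈-concat⁺′ (Mp.∈-map⁺ (glue n i β) mγ) (Mp.∈-map⁺ (λ β → L.map (glue n i β) (Av132 (n ∸ i))) mβ))
    (Mp.∈-map⁺ (λ i → L.concatMap (λ β → L.map (glue n i β) (Av132 (n ∸ i))) (Av132 i)) (Mp.∈-upTo⁺ (s≤s i≤n)))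

Unique-++-disjoint : ∀ {x y : ℕ} xs ys → Unique (xs ++ ys) → x ∈ xs → y ∈ ys → x ≢ y
Unique-++-disjoint (x ∷ xs) ys (h ∷ u) (here refl) my = All.lookup (AllP.++⁻ʳ xs h) my
Unique-++-disjoint (x ∷ xs) ys (h ∷ u) (there mx) my = Unique-++-disjoint xs ys u mx my

orderIso-132 : ∀ x N y → x < y → y < N → orderIso (x ∷ N ∷ y ∷ []) p132 ≡ true
orderIso-132 x N y xy yN rewrite <⇒<ᵇ≡true {x} {N} (NP.<-trans xy yN) | ≥⇒<ᵇ≡false {N} {x} (NP.<⇒≤ (NP.<-trans xy yN))
  | <⇒<ᵇ≡true xy | ≥⇒<ᵇ≡false {y} {x} (NP.<⇒≤ xy) | <⇒<ᵇ≡true yN | ≥⇒<ᵇ≡false {N} {y} (NP.<⇒≤ yN) = refl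

maxL : List ℕ → ℕ
maxL = foldr N._⊔_ 0

maxL-ge : ∀ ys → All (_≤ maxL ys) ys
maxL-ge [] = []
maxL-ge (y ∷ ys) = NP.m≤m⊔n y (maxL ys) ∷ All.map (λ q → NP.≤-trans q (NP.m≤n⊔m y (maxL ys))) (maxL-ge ys)

maxL-lt : ∀ {x} ys → 0 < x → All (_< x) ys → maxL ys < x
maxL-lt [] p h = p
maxL-lt (y ∷ ys) p (q ∷ h) = NP.⊔-lub q (maxL-lt ys p h)

maxL-le : ∀ {n} ys → All (_≤ n) ys → maxL ys ≤ n
maxL-le [] h = z≤n
maxL-le (y ∷ ys) (q ∷ h) = NP.⊔-lub q (maxL-le ys h)

filter-≤-iota : ∀ t k → L.filter (N._≤? t) (iota (t + k)) ≡ iota t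
filter-≤-iota t k = begin
    L.filter (N._≤? t) (iota (t + k)) ≡⟨ cong (L.filter (N._≤? t)) (iota-+ t k) ⟩
    L.filter (N._≤? t) (iota t ++ map (t +_) (iota k)) ≡⟨ Lp.filter-++ (N._≤? t) (iota t) _ ⟩
    L.filter (N._≤? t) (iota t) ++ L.filter (N._≤? t) (map (t +_) (iota k))
      ≡⟨ cong₂ _++_ (Lp.filter-all (N._≤? t) (All.map proj₂ (iota-bounds t)))
                     (Lp.filter-none (N._≤? t) (AllP.map⁺ (All.map (λ (p , _) q → NP.<-irrefl refl (NP.<-≤-trans (subst (_< t + _) (NP.+-identityʳ t) (NP.+-monoʳ-< t p)) q)) (iota-bounds k)))) ⟩
    iota t ++ [] ≡⟨ Lp.++-identityʳ _ ⟩
    iota t ∎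
  where open Eq.≡-Reasoning

filter->-iota : ∀ t k → L.filter (t N.<?_) (iota (t + k)) ≡ map (t +_) (iota k)
filter->-iota t k = begin
    L.filter (t N.<?_) (iota (t + k)) ≡⟨ cong (L.filter (t N.<?_)) (iota-+ t k) ⟩
    L.filter (t N.<?_) (iota t ++ map (t +_) (iota k)) ≡⟨ Lp.filter-++ (t N.<?_) (iota t) _ ⟩
    L.filter (t N.<?_) (iota t) ++ L.filter (t N.<?_) (map (t +_) (iota k))
      ≡⟨ cong₂ _++_ (Lp.filter-none (t N.<?_) (All.map (λ (_ , q) p → NP.<-irrefl refl (NP.<-≤-trans p q)) (iota-bounds t)))
                     (Lp.filter-all (t N.<?_) (AllP.map⁺ (All.map (λ (p , _) → subst (_< t + _) (NP.+-identityʳ t) (NP.+-monoʳ-< t p)) (iota-bounds k)))) ⟩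
    map (t +_) (iota k) ∎
  where open Eq.≡-Reasoning

left-of-max-Separated : ∀ {n xs ys} → IsAv132 (suc n) (xs ++ suc n ∷ ys) → xs ++ ys ↭ iota n × Separated true xs ys
left-of-max-Separated {n} {xs} {ys} h = xs++ys↭ , All.tabulate (λ mx → All.tabulate (λ my → above mx my))
  where
  xs++ys↭ : xs ++ ys ↭ iota n
  xs++ys↭ = ptrans (PP.drop-mid xs (iota n) {zs = []} (IsAv132.perm h)) (↭-reflexive (Lp.++-identityʳ _))
  ys≤n : All (_≤ n) ys
  ys≤n = All.map proj₂ (AllP.++⁻ʳ xs (PP.All-resp-↭ (↭-sym xs++ys↭) (iota-bounds n)))
  above : ∀ {x y} → x ∈ xs → y ∈ ys → y < x
  above {x} {y} mx my with NP.<-cmp x y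
  ... | tri< x<y _ _ = ⊥-elim (IsAv132.av h (x ∷ suc n ∷ y ∷ [] , ++⁺ (from∈ mx) (refl ∷ from∈ my) , orderIso-132 x (suc n) y x<y (s≤s (All.lookup ys≤n my))))
  ... | tri≈ _ x≡y _ = ⊥-elim (Unique-++-disjoint xs ys (Unique-resp-↭ (↭-sym xs++ys↭) (iota-unique n)) mx my x≡y)
  ... | tri> _ _ y<x = y<x

maxL<left : ∀ {xs ys} → Separated true xs ys → All (0 <_) xs → All (maxL ys <_) xs
maxL<left {ys = ys} sep xs>0 = All.zipWith (λ (s , 0<x) → maxL-lt ys 0<x s) (sep , xs>0)

Separated-↭-iota : ∀ {n xs ys} → xs ++ ys ↭ iota n → Separated true xs ys
  → maxL ys ≤ n × xs ↭ map (maxL ys +_) (iota (n ∸ maxL ys)) × ys ↭ iota (maxL ys)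
Separated-↭-iota {n} {xs} {ys} q sep = t≤n , qx , qy
  where
  t : ℕ
  t = maxL ys
  bounds : All (λ x → 0 < x × x ≤ n) (xs ++ ys)
  bounds = PP.All-resp-↭ (↭-sym q) (iota-bounds n)
  t<xs : All (t <_) xs
  t<xs = maxL<left sep (All.map proj₁ (AllP.++⁻ˡ xs bounds))
  t≤n : t ≤ n
  t≤n = maxL-le ys (All.map proj₂ (AllP.++⁻ʳ xs bounds))
  iota-split : n ≡ t + (n ∸ t)
  iota-split = sym (NP.m+[n∸m]≡n t≤n)
  qy : ys ↭ iota t
  qy = ptrans (↭-reflexive (sym filter-++-split)) (ptrans (PP.filter-↭ (N._≤? t) q) (↭-reflexive filter-iota))
    where
    filter-++-split : L.filter (N._≤? t) (xs ++ ys) ≡ ys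
    filter-++-split = trans (Lp.filter-++ (N._≤? t) xs ys) (cong₂ _++_ (Lp.filter-none (N._≤? t) (All.map (λ p q → NP.<-irrefl refl (NP.<-≤-trans p q)) t<xs)) (Lp.filter-all (N._≤? t) (maxL-ge ys)))
    filter-iota : L.filter (N._≤? t) (iota n) ≡ iota t
    filter-iota = trans (cong (λ z → L.filter (N._≤? t) (iota z)) iota-split) (filter-≤-iota t (n ∸ t))
  qx : xs ↭ map (t +_) (iota (n ∸ t))
  qx = ptrans (↭-reflexive (sym filter-++-split)) (ptrans (PP.filter-↭ (t N.<?_) q) (↭-reflexive filter-iota))
    where
    filter-++-split : L.filter (t N.<?_) (xs ++ ys) ≡ xs
    filter-++-split = trans (Lp.filter-++ (t N.<?_) xs ys) (trans (cong₂ _++_ (Lp.filter-all (t N.<?_) t<xs) (Lp.filter-none (t N.<?_) (All.map (λ q p → NP.<-irrefl refl (NP.<-≤-trans p q)) (maxL-ge ys)))) (Lp.++-identityʳ xs))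
    filter-iota : L.filter (t N.<?_) (iota n) ≡ map (t +_) (iota (n ∸ t))
    filter-iota = trans (cong (λ z → L.filter (t N.<?_) (iota z)) iota-split) (filter->-iota t (n ∸ t))

Av132⊆glued : ∀ n {α} → α ∈ Av132 (suc n) → α ∈ glued n
Av132⊆glued n {α} m with Mp.∈-∃++ (PP.∈-resp-↭ (↭-sym (IsAv132.perm (∈Av132⇒IsAv132 (suc n) m))) (Mp.∈-++⁺ʳ (iota n) (here refl)))
... | xs , ys , refl = subst (_∈ glued n) αeq (glue∈glued n k (NP.m∸n≤m n t) mβ mγ)
  where
  h : IsAv132 (suc n) (xs ++ suc n ∷ ys)
  h = ∈Av132⇒IsAv132 (suc n) m
  split : xs ++ ys ↭ iota n × Separated true xs ys
  split = left-of-max-Separated h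
  t : ℕ
  t = maxL ys
  k : ℕ
  k = n ∸ t
  blocks : t ≤ n × xs ↭ map (t +_) (iota k) × ys ↭ iota t
  blocks = Separated-↭-iota (proj₁ split) (proj₂ split)
  β : List ℕ
  β = map (_∸ t) xs
  mapback : map (t +_) β ≡ xs
  mapback = trans (sym (Lp.map-∘ xs)) (Lp.map-id-local (All.map (λ t<x → NP.m+[n∸m]≡n (NP.<⇒≤ t<x))
              (maxL<left (proj₂ split) (All.map proj₁ (AllP.++⁻ˡ xs (PP.All-resp-↭ (↭-sym (proj₁ split)) (iota-bounds n)))))))
  qβ : β ↭ iota k
  qβ = ptrans (PP.map⁺ (_∸ t) (proj₁ (proj₂ blocks))) (↭-reflexive (trans (sym (Lp.map-∘ (iota k))) (trans (Lp.map-cong (λ x → NP.m+n∸m≡n t x) (iota k)) (Lp.map-id (iota k)))))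
  mβ : β ∈ Av132 k
  mβ = IsAv132⇒∈Av132 k (record { perm = qβ ; av = λ c → IsAv132.av h (Contains-mono (++⁺ʳ (suc n ∷ ys) ⊆-refl) (subst (λ z → Contains z p132) mapback (Contains-shiftˡ⁺ t β p132 c))) })
  mγ : ys ∈ Av132 (n ∸ k)
  mγ = subst (λ z → ys ∈ Av132 z) (sym (NP.m∸[m∸n]≡n (proj₁ blocks)))
         (IsAv132⇒∈Av132 t (record { perm = proj₂ (proj₂ blocks) ; av = λ c → IsAv132.av h (Contains-mono (++⁺ˡ xs (suc n ∷ʳ ⊆-refl)) c) }))
  αeq : glue n k β ys ≡ xs ++ suc n ∷ ys
  αeq = cong (_++ suc n ∷ ys) (trans (cong (λ z → map (z +_) β) (NP.m∸[m∸n]≡n (proj₁ blocks))) mapback)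

glued⊆Av132 : ∀ n {z} → z ∈ glued n → z ∈ Av132 (suc n)
glued⊆Av132 n {z} m with Mp.∈-concat⁻′ (L.map (λ i → L.concatMap (λ β → L.map (glue n i β) (Av132 (n ∸ i))) (Av132 i)) (upTo (suc n))) m
... | l , m1 , m2 with Mp.∈-map⁻ (λ i → L.concatMap (λ β → L.map (glue n i β) (Av132 (n ∸ i))) (Av132 i)) m2
... | i , mi , refl with Mp.∈-concat⁻′ (L.map (λ β → L.map (glue n i β) (Av132 (n ∸ i))) (Av132 i)) m1
... | l' , m3 , m4 with Mp.∈-map⁻ (λ β → L.map (glue n i β) (Av132 (n ∸ i))) m4
... | β , mβ , refl with Mp.∈-map⁻ (glue n i β) m3
... | γ , mγ , refl = glue∈Av132 n i (NP.≤-pred (Mp.∈-upTo⁻ mi)) mβ mγ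

splitAtValue : ℕ → List ℕ → List ℕ × List ℕ
splitAtValue a [] = [] , []
splitAtValue a (x ∷ xs) = if x N.≡ᵇ a then ([] , xs) else (x ∷ proj₁ (splitAtValue a xs) , proj₂ (splitAtValue a xs))

splitAtValue-++-∷ : ∀ a xs ys → All (_≢ a) xs → splitAtValue a (xs ++ a ∷ ys) ≡ (xs , ys)
splitAtValue-++-∷ a [] ys [] with a N.≡ᵇ a in eq
... | true = refl
... | false = ⊥-elim (subst T eq (NP.≡⇒≡ᵇ a a refl))
splitAtValue-++-∷ a (x ∷ xs) ys (h ∷ hs) with x N.≡ᵇ a in eq
... | true = ⊥-elim (h (NP.≡ᵇ⇒≡ x a (subst T (sym eq) _)))
... | false rewrite splitAtValue-++-∷ a xs ys hs = refl

splitAtValue-glue : ∀ n i {β} γ → β ∈ Av132 i → i ≤ n → splitAtValue (suc n) (glue n i β γ) ≡ (map ((n ∸ i) +_) β , γ)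
splitAtValue-glue n i {β} γ mβ i≤n = splitAtValue-++-∷ (suc n) (map ((n ∸ i) +_) β) γ
  (AllP.map⁺ (All.map (λ {x} (_ , q) e → NP.<-irrefl e (s≤s (subst ((n ∸ i) + x ≤_) (NP.m∸n+n≡m i≤n) (NP.+-monoʳ-≤ (n ∸ i) q)))) (IsAv132-bounds (∈Av132⇒IsAv132 i mβ))))

glued-unique : ∀ n → Unique (glued n)
glued-unique n = Unique-concatMap fi keyi (upTo (suc n)) (UP.upTo⁺ (suc n)) ulevel kiok
  where
  fβ : ℕ → List ℕ → List (List ℕ)
  fβ i β = L.map (glue n i β) (Av132 (n ∸ i))
  fi : ℕ → List (List ℕ)
  fi i = L.concatMap (fβ i) (Av132 i)
  keyi : List ℕ → ℕ
  keyi z = length (proj₁ (splitAtValue (suc n) z))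
  keyβ : ℕ → List ℕ → List ℕ
  keyβ i z = map (_∸ (n ∸ i)) (proj₁ (splitAtValue (suc n) z))
  uA : ∀ j → Unique (Av132 j)
  uA j = filterB-unique av132 (perms j) (perms-unique j)
  inj : ∀ {i β γ γ'} → glue n i β γ ≡ glue n i β γ' → γ ≡ γ'
  inj {i} {β} e = Lp.∷-injectiveʳ (Lp.++-cancelˡ (map ((n ∸ i) +_) β) _ _ e)
  ulevel : ∀ i → i ∈ upTo (suc n) → Unique (fi i)
  ulevel i mi = Unique-concatMap (fβ i) (keyβ i) (Av132 i) (uA i) (λ β _ → UP.map⁺ (inj {i}) (uA (n ∸ i))) kβok
    where
    i≤n : i ≤ n
    i≤n = NP.≤-pred (Mp.∈-upTo⁻ mi)
    kβok : ∀ β z → β ∈ Av132 i → z ∈ fβ i β → keyβ i z ≡ β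
    kβok β z mβ mz with Mp.∈-map⁻ (glue n i β) mz
    ... | γ , _ , refl rewrite splitAtValue-glue n i γ mβ i≤n =
      trans (sym (Lp.map-∘ β)) (trans (Lp.map-cong (λ x → NP.m+n∸m≡n (n ∸ i) x) β) (Lp.map-id β))
  kiok : ∀ i z → i ∈ upTo (suc n) → z ∈ fi i → keyi z ≡ i
  kiok i z mi mz with Mp.∈-concat⁻′ (L.map (fβ i) (Av132 i)) mz
  ... | l , m3 , m4 with Mp.∈-map⁻ (fβ i) m4
  ... | β , mβ , refl with Mp.∈-map⁻ (glue n i β) m3
  ... | γ , _ , refl rewrite splitAtValue-glue n i γ mβ (NP.≤-pred (Mp.∈-upTo⁻ mi)) =
    trans (Lp.length-map ((n ∸ i) +_) β) (IsAv132-length (∈Av132⇒IsAv132 i mβ))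

-- Counting

sumL : ∀ {A : Set} → (A → ℤ) → List A → ℤ
sumL g [] = 0ℤ
sumL g (x ∷ xs) = g x +ℤ sumL g xs

sumL-++ : ∀ {A : Set} (g : A → ℤ) xs ys → sumL g (xs ++ ys) ≡ sumL g xs +ℤ sumL g ys
sumL-++ g [] ys = sym (ZP.+-identityˡ _)
sumL-++ g (x ∷ xs) ys rewrite sumL-++ g xs ys = sym (ZP.+-assoc (g x) _ _)

sumL-concatMap : ∀ {A B : Set} (g : B → ℤ) (f : A → List B) xs → sumL g (L.concatMap f xs) ≡ sumL (λ x → sumL g (f x)) xs
sumL-concatMap g f [] = refl
sumL-concatMap g f (x ∷ xs) = trans (sumL-++ g (f x) (L.concatMap f xs)) (cong (sumL g (f x) +ℤ_) (sumL-concatMap g f xs))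

sumL-map : ∀ {A B : Set} (g : B → ℤ) (h : A → B) xs → sumL g (map h xs) ≡ sumL (g ∘ h) xs
sumL-map g h [] = refl
sumL-map g h (x ∷ xs) = cong (g (h x) +ℤ_) (sumL-map g h xs)

sumL-ext : ∀ {A : Set} (g h : A → ℤ) xs → (∀ x → x ∈ xs → g x ≡ h x) → sumL g xs ≡ sumL h xs
sumL-ext g h [] e = refl
sumL-ext g h (x ∷ xs) e = cong₂ _+ℤ_ (e x (here refl)) (sumL-ext g h xs (λ y m → e y (there m)))

sumL-upTo : ∀ (g : ℕ → ℤ) m → sumL g (upTo m) ≡ sumTo g m
sumL-upTo g = go g id
  where
  go : ∀ (g : ℕ → ℤ) (f : ℕ → ℕ) m → sumL g (applyUpTo f m) ≡ sumTo (g ∘ f) m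
  go g f zero = refl
  go g f (suc m) = cong (g (f 0) +ℤ_) (go g (f ∘ suc) m)

sumL-sumTo : ∀ {A : Set} (g : ℕ → A → ℤ) L xs → sumL (λ x → sumTo (λ j → g j x) L) xs ≡ sumTo (λ j → sumL (g j) xs) L
sumL-sumTo g L [] = sym (sumTo-zero _ L (λ _ → refl))
sumL-sumTo g L (x ∷ xs) rewrite sumL-sumTo g L xs = sym (sumTo-+ (λ j → g j x) (λ j → sumL (g j) xs) L)

sumL-*ʳ : ∀ {A : Set} (g : A → ℤ) c xs → sumL (λ x → g x *ℤ c) xs ≡ sumL g xs *ℤ c
sumL-*ʳ g c [] = sym (ZP.*-zeroˡ c)
sumL-*ʳ g c (x ∷ xs) rewrite sumL-*ʳ g c xs = sym (ZP.*-distribʳ-+ c (g x) (sumL g xs))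

sumL-*ˡ : ∀ {A : Set} (g : A → ℤ) c xs → sumL (λ x → c *ℤ g x) xs ≡ c *ℤ sumL g xs
sumL-*ˡ g c [] = sym (ZP.*-zeroʳ c)
sumL-*ˡ g c (x ∷ xs) rewrite sumL-*ˡ g c xs = sym (ZP.*-distribˡ-+ c (g x) (sumL g xs))

sumL-- : ∀ {A : Set} (g h : A → ℤ) xs → sumL (λ x → g x -ℤ h x) xs ≡ sumL g xs -ℤ sumL h xs
sumL-- g h [] = refl
sumL-- g h (x ∷ xs) rewrite sumL-- g h xs = medial-sub (g x) (h x) (sumL g xs) (sumL h xs)
  where
  open +-*-Solver
  medial-sub : ∀ a b c d → (a -ℤ b) +ℤ (c -ℤ d) ≡ (a +ℤ c) -ℤ (b +ℤ d)
  medial-sub = solve 4 (λ a b c d → (a :- b) :+ (c :- d) := (a :+ c) :- (b :+ d)) refl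

sumL-mid : ∀ {A : Set} (g : A → ℤ) as x bs → sumL g (as ++ x ∷ bs) ≡ g x +ℤ sumL g (as ++ bs)
sumL-mid g [] x bs = refl
sumL-mid g (a ∷ as) x bs rewrite sumL-mid g as x bs = left-comm (g a) (g x) (sumL g (as ++ bs))
  where
  open +-*-Solver
  left-comm : ∀ a b c → a +ℤ (b +ℤ c) ≡ b +ℤ (a +ℤ c)
  left-comm = solve 3 (λ a b c → a :+ (b :+ c) := b :+ (a :+ c)) refl

∈-mid⁻ : ∀ {A : Set} {y x : A} as bs → y ∈ as ++ x ∷ bs → y ≢ x → y ∈ as ++ bs
∈-mid⁻ [] bs (here e) n = ⊥-elim (n e)
∈-mid⁻ [] bs (there m) n = m
∈-mid⁻ (a ∷ as) bs (here e) n = here e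
∈-mid⁻ (a ∷ as) bs (there m) n = there (∈-mid⁻ as bs m n)

∈-mid⁺ : ∀ {A : Set} {y x : A} as bs → y ∈ as ++ bs → y ∈ as ++ x ∷ bs
∈-mid⁺ [] bs m = there m
∈-mid⁺ (a ∷ as) bs (here e) = here e
∈-mid⁺ (a ∷ as) bs (there m) = there (∈-mid⁺ as bs m)

sumL-sameElements : ∀ {A : Set} (g : A → ℤ) L1 L2 → Unique L1 → Unique L2 → (∀ x → x ∈ L1 → x ∈ L2) → (∀ x → x ∈ L2 → x ∈ L1)
  → sumL g L1 ≡ sumL g L2
sumL-sameElements g [] [] u1 u2 i1 i2 = refl
sumL-sameElements g [] (y ∷ L2) u1 u2 i1 i2 with i2 y (here refl)
... | ()
sumL-sameElements g (x ∷ L1) L2 (h ∷ u1) u2 i1 i2 with Mp.∈-∃++ (i1 x (here refl))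
... | as , bs , refl = trans (cong (g x +ℤ_) (sumL-sameElements g L1 (as ++ bs) u1 u2' j1 j2)) (sym (sumL-mid g as x bs))
  where
  u2x : Unique (x ∷ as ++ bs)
  u2x = Unique-resp-↭ (PP.shift x as bs) u2
  u2' : Unique (as ++ bs)
  u2' with u2x
  ... | _ ∷ u = u
  xnot : ∀ {y} → y ∈ as ++ bs → x ≢ y
  xnot m with u2x
  ... | hx ∷ _ = All.lookup hx m
  j1 : ∀ y → y ∈ L1 → y ∈ as ++ bs
  j1 y m = ∈-mid⁻ as bs (i1 y (there m)) (λ e → All.lookup h m (sym e))
  j2 : ∀ y → y ∈ as ++ bs → y ∈ L1
  j2 y m with i2 y (∈-mid⁺ as bs m)
  ... | here e = ⊥-elim (xnot m (sym e))
  ... | there m' = m'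

𝟙 : Bool → ℤ
𝟙 true = 1ℤ
𝟙 false = 0ℤ

countB≡sumL : ∀ (q p : List ℕ → Bool) l → Z.+ countB (λ α → q α ∧ p α) l ≡ sumL (λ α → 𝟙 (p α)) (filterB q l)
countB≡sumL q p [] = refl
countB≡sumL q p (x ∷ l) with q x
... | true = trans (𝟙-+ (p x) (countB (λ α → q α ∧ p α) l)) (cong (𝟙 (p x) +ℤ_) (countB≡sumL q p l))
  where
  𝟙-+ : ∀ b c → Z.+ ((if b then 1 else 0) + c) ≡ 𝟙 b +ℤ Z.+ c
  𝟙-+ true c = refl
  𝟙-+ false c = refl
... | false = countB≡sumL q p l

F≡sumL-Av132 : ∀ τ m → F τ m ≡ sumL (λ α → 𝟙 (avoids α τ)) (Av132 m)
F≡sumL-Av132 τ m = countB≡sumL av132 (λ α → avoids α τ) (perms m)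

countB-cong : ∀ (p q : List ℕ → Bool) l → (∀ α → p α ≡ q α) → countB p l ≡ countB q l
countB-cong p q [] e = refl
countB-cong p q (x ∷ l) e rewrite e x | countB-cong p q l e = refl

F-shift : ∀ c T → F (map (c +_) T) ≈ F T
F-shift c T n = cong Z.+_ (countB-cong _ _ (perms n) (λ α → cong (λ z → av132 α ∧ not z)
  (Bool-⇔⇒≡ _ _ (λ e → Contains⇒contains α T (Contains-shiftʳ⁻ c α T (contains⇒Contains α _ e))) (λ e → Contains⇒contains α _ (Contains-shiftʳ⁺ c α T (contains⇒Contains α T e))))))

F-[] : F [] ≈ zeroS
F-[] n = cong Z.+_ (trans (countB-cong _ (λ _ → false) (perms n) (λ α → trans (cong (λ z → av132 α ∧ not z) (Contains⇒contains α [] (Contains-[] α))) (BP.∧-zeroʳ (av132 α)))) (countB-false (perms n)))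
  where
  countB-false : ∀ l → countB (λ _ → false) l ≡ 0
  countB-false [] = refl
  countB-false (x ∷ l) = countB-false l

antitone-false : ∀ (x : ℕ → Bool) → (∀ j → x (suc j) ≡ true → x j ≡ true) → x 1 ≡ false → ∀ j → x (suc j) ≡ false
antitone-false x x↓ x₁ zero = x₁
antitone-false x x↓ x₁ (suc j) with x (suc (suc j)) in e
... | false = refl
... | true with () ← trans (sym (antitone-false x x↓ x₁ j)) (x↓ (suc j) e)

-- With aⱼ = 𝟙 (not (x j)) stepping once from 0 to 1, the sum collapses to the single
-- term at the last j with x j, and b holds exactly when y holds there.
indicator-telescope : ∀ (x y : ℕ → Bool) (b : Bool) L → x 0 ≡ true → y L ≡ true
  → (∀ j → x (suc j) ≡ true → x j ≡ true) → (∀ j → y j ≡ true → y (suc j) ≡ true)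
  → (b ≡ true → ∃[ j ] (j ≤ L × x j ≡ true × y j ≡ true))
  → (∀ j → j ≤ L → x j ≡ true → y j ≡ true → b ≡ true)
  → 𝟙 (not b) ≡ sumTo (λ j → (𝟙 (not (x (suc j))) -ℤ 𝟙 (not (x j))) *ℤ 𝟙 (not (y j))) L
indicator-telescope x y b zero x₀ y_L x↓ y↑ b⇒ b⇐ rewrite b⇐ 0 z≤n x₀ y_L = refl
indicator-telescope x y b (suc L) x₀ y_L x↓ y↑ b⇒ b⇐ with x 1 in x₁
... | false = begin
    𝟙 (not b)                              ≡⟨ cong (𝟙 ∘ not) b≡y₀ ⟩
    𝟙 (not (y 0))                          ≡⟨ ZP.+-identityʳ _ ⟨
    𝟙 (not (y 0)) +ℤ 0ℤ                    ≡⟨ cong₂ _+ℤ_ first-term (sumTo-zero _ L later-terms) ⟨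
    (𝟙 (not false) -ℤ 𝟙 (not (x 0))) *ℤ 𝟙 (not (y 0)) +ℤ sumTo (λ j → (𝟙 (not (x (suc (suc j)))) -ℤ 𝟙 (not (x (suc j)))) *ℤ 𝟙 (not (y (suc j)))) L ∎
  where
  open Eq.≡-Reasoning
  x-false : ∀ j → x (suc j) ≡ false
  x-false = antitone-false x x↓ x₁
  b≡y₀ : b ≡ y 0
  b≡y₀ = Bool-⇔⇒≡ b (y 0) b⇒y₀ (b⇐ 0 z≤n x₀)
    where
    b⇒y₀ : b ≡ true → y 0 ≡ true
    b⇒y₀ eb with b⇒ eb
    ... | zero , _ , _ , y₀ = y₀
    ... | suc j , _ , xⱼ , _ with () ← trans (sym (x-false j)) xⱼ
  first-term : (𝟙 (not false) -ℤ 𝟙 (not (x 0))) *ℤ 𝟙 (not (y 0)) ≡ 𝟙 (not (y 0))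
  first-term rewrite x₀ = ZP.*-identityˡ _
  later-terms : ∀ j → (𝟙 (not (x (suc (suc j)))) -ℤ 𝟙 (not (x (suc j)))) *ℤ 𝟙 (not (y (suc j))) ≡ 0ℤ
  later-terms j rewrite x-false j | x-false (suc j) = ZP.*-zeroˡ (𝟙 (not (y (suc j))))
... | true = begin
    𝟙 (not b)                              ≡⟨ indicator-telescope (x ∘ suc) (y ∘ suc) b L x₁ y_L (x↓ ∘ suc) (y↑ ∘ suc) b⇒′ b⇐′ ⟩
    rest                                   ≡⟨ ZP.+-identityˡ rest ⟨
    0ℤ +ℤ rest                             ≡⟨ cong (_+ℤ rest) first-term ⟨
    (𝟙 (not true) -ℤ 𝟙 (not (x 0))) *ℤ 𝟙 (not (y 0)) +ℤ rest ∎
  where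
  open Eq.≡-Reasoning
  rest : ℤ
  rest = sumTo (λ j → (𝟙 (not (x (suc (suc j)))) -ℤ 𝟙 (not (x (suc j)))) *ℤ 𝟙 (not (y (suc j)))) L
  b⇒′ : b ≡ true → ∃[ j ] (j ≤ L × x (suc j) ≡ true × y (suc j) ≡ true)
  b⇒′ e with b⇒ e
  ... | zero , _ , _ , y₀ = 0 , z≤n , x₁ , y↑ 0 y₀
  ... | suc j , s≤s j≤L , xⱼ , yⱼ = j , j≤L , xⱼ , yⱼ
  b⇐′ : ∀ j → j ≤ L → x (suc j) ≡ true → y (suc j) ≡ true → b ≡ true
  b⇐′ j j≤L = b⇐ (suc j) (s≤s j≤L)
  first-term : (𝟙 (not true) -ℤ 𝟙 (not (x 0))) *ℤ 𝟙 (not (y 0)) ≡ 0ℤ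
  first-term rewrite x₀ = ZP.*-zeroˡ (𝟙 (not (y 0)))

-- α = u ++ γ with u above γ contains τ iff τ is cut at some layer boundary into a prefix
-- contained in u and a suffix contained in γ; both conditions are monotone in the boundary.
module Glued {ms : List ℕ} (dl : Decreasing ms) {n i : ℕ} {β γ : List ℕ} (i≤n : i ≤ n) (hβ : IsAv132 i β) (hγ : IsAv132 (n ∸ i) γ) where
  τ : List ℕ
  τ = layered ms
  a : ℕ
  a = hd ms
  Ln : ℕ
  Ln = length ms
  c : ℕ
  c = n ∸ i
  w : List ℕ
  w = map (c +_) β
  u : List ℕ
  u = w ++ suc n ∷ []
  w<max : All (_< suc n) w
  w<max = glue-<max i≤n hβ
  u-above-γ : Separated true u γ
  u-above-γ = glue-Separated i≤n hβ hγ
  glue≡u++γ : glue n i β γ ≡ u ++ γ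
  glue≡u++γ = sym (Lp.++-assoc w (suc n ∷ []) γ)

  prefixIn-u : ℕ → Bool
  prefixIn-u j = contains u (take (a ∸ nth ms j) τ)
  suffixIn-γ : ℕ → Bool
  suffixIn-γ j = contains γ (drop (a ∸ nth ms j) τ)
  τIn-α : Bool
  τIn-α = contains (glue n i β γ) τ

  length-τ : length τ ≡ a
  length-τ = length-layered dl

  prefixIn-u-zero : prefixIn-u 0 ≡ true
  prefixIn-u-zero rewrite NP.n∸n≡0 a = Contains⇒contains u [] (Contains-[] u)

  suffixIn-γ-last : suffixIn-γ Ln ≡ true
  suffixIn-γ-last rewrite nth-length ms | Lp.drop-all a τ (NP.≤-reflexive length-τ) = Contains⇒contains γ [] (Contains-[] γ)

  cut-monotone : ∀ j → a ∸ nth ms j ≤ a ∸ nth ms (suc j)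
  cut-monotone j = NP.∸-monoʳ-≤ a (nth-mono dl j)

  prefixIn-u-antitone : ∀ j → prefixIn-u (suc j) ≡ true → prefixIn-u j ≡ true
  prefixIn-u-antitone j e = Contains⇒contains u _ (subst (Contains u) tt (Contains-take p u (take p' τ) (contains⇒Contains u _ e)))
    where
    p p' : ℕ
    p = a ∸ nth ms j
    p' = a ∸ nth ms (suc j)
    tt : take p (take p' τ) ≡ take p τ
    tt = trans (Lp.take-take p p' τ) (cong (λ z → take z τ) (NP.m≤n⇒m⊓n≡m (cut-monotone j)))

  suffixIn-γ-monotone : ∀ j → suffixIn-γ j ≡ true → suffixIn-γ (suc j) ≡ true
  suffixIn-γ-monotone j e = Contains⇒contains γ _ (subst (Contains γ) dd (Contains-drop (p' ∸ p) γ (drop p τ) (contains⇒Contains γ _ e)))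
    where
    p p' : ℕ
    p = a ∸ nth ms j
    p' = a ∸ nth ms (suc j)
    dd : drop (p' ∸ p) (drop p τ) ≡ drop p' τ
    dd = trans (Lp.drop-drop p (p' ∸ p) τ) (cong (λ z → drop z τ) (NP.m+[n∸m]≡n (cut-monotone j)))

  τIn-α⇒cut : τIn-α ≡ true → ∃[ j ] (j ≤ Ln × prefixIn-u j ≡ true × suffixIn-γ j ≡ true)
  τIn-α⇒cut e with Contains-++⁻ true u γ τ u-above-γ (subst (λ z → Contains z τ) glue≡u++γ (contains⇒Contains _ τ e))
  ... | p , c1 , c2 , cx with p N.≤? a
  ...   | yes pa with Separated-layered-cut dl p pa cx
  ...     | j , jl , refl = j , jl , Contains⇒contains u _ c1 , Contains⇒contains γ _ c2
  τIn-α⇒cut e | p , c1 , c2 , cx | no pa = Ln , NP.≤-refl , Contains⇒contains u _ (subst (Contains u) tk c1) , suffixIn-γ-last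
    where
    tk : take p τ ≡ take (a ∸ nth ms Ln) τ
    tk rewrite nth-length ms = trans (Lp.take-all p τ (subst (_≤ p) (sym length-τ) (NP.<⇒≤ (NP.≰⇒> pa)))) (sym (Lp.take-all a τ (NP.≤-reflexive length-τ)))

  cut⇒τIn-α : ∀ j → j ≤ Ln → prefixIn-u j ≡ true → suffixIn-γ j ≡ true → τIn-α ≡ true
  cut⇒τIn-α j jl ex ey = Contains⇒contains _ τ (subst (λ z → Contains z τ) (sym glue≡u++γ)
    (Contains-++⁺ true u γ τ (a ∸ nth ms j) u-above-γ (contains⇒Contains u _ ex) (contains⇒Contains γ _ ey) (layered-cut-Separated dl j)))

  prefixIn-u≡prefixIn-β : ∀ j → j ≤ Ln → prefixIn-u j ≡ contains β (take (prefixLength ms j) τ)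
  prefixIn-u≡prefixIn-β j jl = Bool-⇔⇒≡ _ _
    (λ e → Contains⇒contains β _ (Contains-shiftˡ⁻ c β _ (Contains-∷ʳ-max-prefix⁻ dl w (suc n) w<max j jl (contains⇒Contains u _ e))))
    (λ e → Contains⇒contains u _ (Contains-∷ʳ-max-prefix⁺ dl w (suc n) w<max j jl (Contains-shiftˡ⁺ c β _ (contains⇒Contains β _ e))))

  𝟙-avoids-glue : 𝟙 (avoids (glue n i β γ) τ) ≡ sumTo (λ j → (𝟙 (avoids β (take (prefixLength ms (suc j)) τ)) -ℤ 𝟙 (avoids β (take (prefixLength ms j) τ))) *ℤ 𝟙 (avoids γ (drop (a ∸ nth ms j) τ))) Ln
  𝟙-avoids-glue = trans (indicator-telescope prefixIn-u suffixIn-γ τIn-α Ln prefixIn-u-zero suffixIn-γ-last prefixIn-u-antitone suffixIn-γ-monotone τIn-α⇒cut cut⇒τIn-α)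
    (sumTo-cong _ _ Ln (λ j jl → cong₂ (λ z1 z2 → (𝟙 (not z1) -ℤ 𝟙 (not z2)) *ℤ 𝟙 (not (suffixIn-γ j))) (prefixIn-u≡prefixIn-β (suc j) jl) (prefixIn-u≡prefixIn-β j (NP.<⇒≤ jl))))

-- The recurrence for layered patterns

prefixF : List ℕ → ℕ → Series
prefixF ms j = F (take (prefixLength ms j) (layered ms))

suffixF : List ℕ → ℕ → Series
suffixF ms j = F (drop (hd ms ∸ nth ms j) (layered ms))

module Coefficient {ms : List ℕ} (dl : Decreasing ms) (n : ℕ) where
  τ : List ℕ
  τ = layered ms
  a : ℕ
  a = hd ms
  Ln : ℕ
  Ln = length ms
  FA : ℕ → Series
  FA = prefixF ms
  FB : ℕ → Series
  FB = suffixF ms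
  g : List ℕ → ℤ
  g α = 𝟙 (avoids α τ)
  fβ : ℕ → List ℕ → List (List ℕ)
  fβ i β = L.map (glue n i β) (Av132 (n ∸ i))
  fi : ℕ → List (List ℕ)
  fi i = L.concatMap (fβ i) (Av132 i)
  Aβ : ℕ → List ℕ → ℤ
  Aβ j β = 𝟙 (avoids β (take (prefixLength ms (suc j)) τ)) -ℤ 𝟙 (avoids β (take (prefixLength ms j) τ))
  Bγ : ℕ → List ℕ → ℤ
  Bγ j γ = 𝟙 (avoids γ (drop (a ∸ nth ms j) τ))

  inner : ∀ i → i ∈ upTo (suc n) → sumL g (fi i) ≡ sumTo (λ j → (FA (suc j) i -ℤ FA j i) *ℤ FB j (n ∸ i)) Ln
  inner i mi = begin
      sumL g (fi i)
    ≡⟨ sumL-concatMap g (fβ i) (Av132 i) ⟩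
      sumL (λ β → sumL g (fβ i β)) (Av132 i)
    ≡⟨ sumL-ext _ _ (Av132 i) (λ β mβ → trans (sumL-map g (glue n i β) (Av132 (n ∸ i)))
          (sumL-ext _ _ (Av132 (n ∸ i)) (λ γ mγ → Glued.𝟙-avoids-glue dl i≤n (∈Av132⇒IsAv132 i mβ) (∈Av132⇒IsAv132 (n ∸ i) mγ)))) ⟩
      sumL (λ β → sumL (λ γ → sumTo (λ j → Aβ j β *ℤ Bγ j γ) Ln) (Av132 (n ∸ i))) (Av132 i)
    ≡⟨ sumL-ext _ _ (Av132 i) (λ β _ → trans (sumL-sumTo (λ j γ → Aβ j β *ℤ Bγ j γ) Ln (Av132 (n ∸ i)))
          (sumTo-cong _ _ Ln (λ j _ → sumL-*ˡ (Bγ j) (Aβ j β) (Av132 (n ∸ i))))) ⟩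
      sumL (λ β → sumTo (λ j → Aβ j β *ℤ sumL (Bγ j) (Av132 (n ∸ i))) Ln) (Av132 i)
    ≡⟨ sumL-sumTo (λ j β → Aβ j β *ℤ sumL (Bγ j) (Av132 (n ∸ i))) Ln (Av132 i) ⟩
      sumTo (λ j → sumL (λ β → Aβ j β *ℤ sumL (Bγ j) (Av132 (n ∸ i))) (Av132 i)) Ln
    ≡⟨ sumTo-cong _ _ Ln (λ j _ → trans (sumL-*ʳ (Aβ j) _ (Av132 i))
          (cong₂ _*ℤ_ (trans (sumL-- _ _ (Av132 i)) (sym (cong₂ _-ℤ_ (F≡sumL-Av132 _ i) (F≡sumL-Av132 _ i)))) (sym (F≡sumL-Av132 _ (n ∸ i))))) ⟩
      sumTo (λ j → (FA (suc j) i -ℤ FA j i) *ℤ FB j (n ∸ i)) Ln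
    ∎
    where
    open Eq.≡-Reasoning
    i≤n : i ≤ n
    i≤n = NP.≤-pred (Mp.∈-upTo⁻ mi)

  F-layered-suc : F τ (suc n) ≡ sumTo (λ j → ((FA (suc j) ⊖ FA j) ⊛ FB j) n) Ln
  F-layered-suc = begin
      F τ (suc n)
    ≡⟨ F≡sumL-Av132 τ (suc n) ⟩
      sumL g (Av132 (suc n))
    ≡⟨ sumL-sameElements g (Av132 (suc n)) (glued n) (filterB-unique av132 (perms (suc n)) (perms-unique (suc n))) (glued-unique n)
         (λ _ → Av132⊆glued n) (λ _ → glued⊆Av132 n) ⟩
      sumL g (glued n)
    ≡⟨ sumL-concatMap g fi (upTo (suc n)) ⟩
      sumL (λ i → sumL g (fi i)) (upTo (suc n))
    ≡⟨ sumL-ext _ _ (upTo (suc n)) inner ⟩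
      sumL (λ i → sumTo (λ j → (FA (suc j) i -ℤ FA j i) *ℤ FB j (n ∸ i)) Ln) (upTo (suc n))
    ≡⟨ sumL-upTo (λ i → sumTo (λ j → (FA (suc j) i -ℤ FA j i) *ℤ FB j (n ∸ i)) Ln) (suc n) ⟩
      sumTo (λ i → sumTo (λ j → (FA (suc j) i -ℤ FA j i) *ℤ FB j (n ∸ i)) Ln) (suc n)
    ≡⟨ sumTo-swap (λ j i → (FA (suc j) i -ℤ FA j i) *ℤ FB j (n ∸ i)) (suc n) Ln ⟩
      sumTo (λ j → cauchy (FA (suc j) ⊖ FA j) (FB j) n) Ln
    ≡⟨ sumTo-cong _ _ Ln (λ j _ → sym (⊛-cauchy (FA (suc j) ⊖ FA j) (FB j) n)) ⟩
      sumTo (λ j → ((FA (suc j) ⊖ FA j) ⊛ FB j) n) Ln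
    ∎
    where open Eq.≡-Reasoning

  F-layered-zero : F τ 0 ≡ 1ℤ
  F-layered-zero = go τ (subst (0 <_) (sym (length-layered dl)) (hd>0 dl))
    where
    go : ∀ t → 0 < length t → F t 0 ≡ 1ℤ
    go (x ∷ t) _ = refl

F-layered-recurrence : ∀ {ms} → Decreasing ms
  → F (layered ms) ≈ one ⊕ X ⊛ ∑S (λ j → (prefixF ms (suc j) ⊖ prefixF ms j) ⊛ suffixF ms j) (length ms)
F-layered-recurrence {ms} dl zero = trans (Coefficient.F-layered-zero dl 0) (sym (cong (1ℤ +ℤ_) (X⊛-coeff-zero (∑S h (length ms)))))
  where
  h : ℕ → Series
  h j = (prefixF ms (suc j) ⊖ prefixF ms j) ⊛ suffixF ms j
F-layered-recurrence {ms} dl (suc n) = trans (Coefficient.F-layered-suc dl n) (sym (trans (ZP.+-identityˡ _) (trans (X⊛-coeff-suc (∑S h (length ms)) n) (∑S-coeff h (length ms) n))))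
  where
  h : ℕ → Series
  h j = (prefixF ms (suc j) ⊖ prefixF ms j) ⊛ suffixF ms j

take-layered-single : ∀ k → take k (layered (suc k ∷ [])) ≡ layered (k ∷ [])
take-layered-single k = begin
    take k (layered (suc k ∷ [])) ≡⟨ cong (take k) (trans (layered-single (suc k)) (run-∷ʳ 0 k)) ⟩
    take k (run 0 k ++ suc k ∷ []) ≡⟨ cong (λ z → take z (run 0 k ++ suc k ∷ [])) (sym (trans (NP.+-identityʳ _) (length-run 0 k))) ⟩
    take (length (run 0 k) + 0) (run 0 k ++ suc k ∷ []) ≡⟨ take-length-++ (run 0 k) _ 0 ⟩
    run 0 k ++ [] ≡⟨ Lp.++-identityʳ _ ⟩
    run 0 k ≡⟨ sym (layered-single k) ⟩
    layered (k ∷ []) ∎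
  where open Eq.≡-Reasoning

F-increasing-recurrence : ∀ k → F (layered (suc k ∷ [])) ≈ one ⊕ X ⊛ (F (layered (k ∷ [])) ⊛ F (layered (suc k ∷ [])))
F-increasing-recurrence k = ≈-trans (F-layered-recurrence dl) (⊕-cong {one} {one} (λ n → refl) (⊛-cong {X} {X} (λ n → refl) single-term))
  where
  dl : Decreasing (suc k ∷ [])
  dl = last (s≤s z≤n)
  single-term : ∑S (λ j → (prefixF (suc k ∷ []) (suc j) ⊖ prefixF (suc k ∷ []) j) ⊛ suffixF (suc k ∷ []) j) 1 ≈ F (layered (k ∷ [])) ⊛ F (layered (suc k ∷ []))
  single-term n = trans (ZP.+-identityʳ _) (⊛-cong {prefixF (suc k ∷ []) 1 ⊖ prefixF (suc k ∷ []) 0} prefix-step suffix-zero n)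
    where
    prefix-step : prefixF (suc k ∷ []) 1 ⊖ prefixF (suc k ∷ []) 0 ≈ F (layered (k ∷ []))
    prefix-step n = trans (cong₂ _-ℤ_ (cong (λ z → F z n) (take-layered-single k)) (F-[] n)) (ZP.+-identityʳ _)
    suffix-zero : suffixF (suc k ∷ []) 0 ≈ F (layered (suc k ∷ []))
    suffix-zero n rewrite NP.n∸n≡0 k = refl

F-increasing≈R : ∀ k → F (layered (k ∷ [])) ≈ R k
F-increasing≈R = recurrence⇒≈R (λ k → F (layered (k ∷ []))) F-[] F-increasing-recurrence

-- Solving the recurrence

drop-applyUpTo : ∀ (f : ℕ → ℕ) j k → drop j (applyUpTo f (j + k)) ≡ applyUpTo (λ i → f (j + i)) k
drop-applyUpTo f zero k = refl
drop-applyUpTo f (suc j) k = drop-applyUpTo (f ∘ suc) j k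

take-applyUpTo : ∀ (f : ℕ → ℕ) j k → take j (applyUpTo f (j + k)) ≡ applyUpTo f j
take-applyUpTo f zero k = refl
take-applyUpTo f (suc j) k = cong (f 0 ∷_) (take-applyUpTo (f ∘ suc) j k)

map-range : ∀ {A : Set} (g : ℕ → A) j k → map g (range j k) ≡ applyUpTo (λ i → g (j + i)) (suc k ∸ j)
map-range g j k = trans (sym (Lp.map-∘ (upTo (suc k ∸ j)))) (Lp.map-upTo (λ i → g (j + i)) (suc k ∸ j))

nth-applyUpTo : ∀ (f : ℕ → ℕ) k j → j < k → nth (applyUpTo f k) j ≡ f j
nth-applyUpTo f (suc k) zero _ = refl
nth-applyUpTo f (suc k) (suc j) (s≤s p) = nth-applyUpTo (f ∘ suc) k j p

Decreasing-applyUpTo : ∀ r (m : ℕ → ℕ) → (∀ i → i < r → m (suc i) < m i) → 0 < m r → Decreasing (applyUpTo m (suc r))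
Decreasing-applyUpTo zero m d p = last p
Decreasing-applyUpTo (suc r) m d p = cons (d 0 (s≤s z≤n)) (Decreasing-applyUpTo r (m ∘ suc) (λ i q → d (suc i) (s≤s q)) p)

sumS-applyUpTo : ∀ (g : ℕ → Series) k → sumS (applyUpTo g k) ≡ ∑S g k
sumS-applyUpTo g zero = refl
sumS-applyUpTo g (suc k) = cong (g 0 ⊕_) (sumS-applyUpTo (g ∘ suc) k)

map-range≡drop : ∀ (m : ℕ → ℕ) R j → j ≤ suc R → map m (range j R) ≡ drop j (applyUpTo m (suc R))
map-range≡drop m R j j≤ = begin
    map m (range j R)                                  ≡⟨ map-range m j R ⟩
    applyUpTo (λ i → m (j + i)) (suc R ∸ j)            ≡⟨ drop-applyUpTo m j (suc R ∸ j) ⟨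
    drop j (applyUpTo m (j + (suc R ∸ j)))             ≡⟨ cong (λ z → drop j (applyUpTo m z)) (NP.m+[n∸m]≡n j≤) ⟩
    drop j (applyUpTo m (suc R))                       ∎
  where open Eq.≡-Reasoning

map-range≡take : ∀ (m : ℕ → ℕ) R j → j ≤ R
  → map (λ i → m i ∸ m (suc j)) (range 0 j) ≡ map (_∸ m (suc j)) (take (suc j) (applyUpTo m (suc R)))
map-range≡take m R j j≤ = begin
    map (λ i → m i ∸ m (suc j)) (range 0 j)            ≡⟨ map-range (λ i → m i ∸ m (suc j)) 0 j ⟩
    applyUpTo (λ i → m i ∸ m (suc j)) (suc j)          ≡⟨ Lp.map-applyUpTo m (_∸ m (suc j)) (suc j) ⟨
    map (_∸ m (suc j)) (applyUpTo m (suc j))           ≡⟨ cong (map (_∸ m (suc j))) (take-applyUpTo m (suc j) (R ∸ j)) ⟨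
    map (_∸ m (suc j)) (take (suc j) (applyUpTo m (suc j + (R ∸ j))))
      ≡⟨ cong (λ z → map (_∸ m (suc j)) (take (suc j) (applyUpTo m (suc z)))) (NP.m+[n∸m]≡n j≤) ⟩
    map (_∸ m (suc j)) (take (suc j) (applyUpTo m (suc R))) ∎
  where open Eq.≡-Reasoning

take-first-layer-pred : ∀ {ms} → Decreasing ms → take (hd ms ∸ nth ms 1 ∸ 1) (layered ms) ≡ map (nth ms 1 +_) (layered ((hd ms ∸ nth ms 1 ∸ 1) ∷ []))
take-first-layer-pred {ms} dl = begin
    take D (layered ms) ≡⟨ sym (trans (Lp.take-take D (suc D) (layered ms)) (cong (λ z → take z (layered ms)) (NP.m≤n⇒m⊓n≡m (NP.n≤1+n D)))) ⟩
    take D (take (suc D) (layered ms)) ≡⟨ cong (λ z → take D (take z (layered ms))) sp ⟩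
    take D (take (hd ms ∸ m1) (layered ms)) ≡⟨ cong (take D) (trans (take-first-layer dl) (cong (run m1) (sym sp))) ⟩
    take D (run m1 (suc D)) ≡⟨ cong (take D) (run-∷ʳ m1 D) ⟩
    take D (run m1 D ++ (m1 + suc D) ∷ []) ≡⟨ cong (λ z → take z (run m1 D ++ (m1 + suc D) ∷ [])) (sym (trans (NP.+-identityʳ _) (length-run m1 D))) ⟩
    take (length (run m1 D) + 0) (run m1 D ++ (m1 + suc D) ∷ []) ≡⟨ take-length-++ (run m1 D) _ 0 ⟩
    run m1 D ++ [] ≡⟨ Lp.++-identityʳ _ ⟩
    run m1 D ≡⟨ cong (λ z → run z D) (sym (NP.+-identityʳ m1)) ⟩
    run (m1 + 0) D ≡⟨ sym (map-+-run m1 0 D) ⟩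
    map (m1 +_) (run 0 D) ≡⟨ cong (map (m1 +_)) (sym (layered-single D)) ⟩
    map (m1 +_) (layered (D ∷ [])) ∎
  where
  open Eq.≡-Reasoning
  m1 D : ℕ
  m1 = nth ms 1
  D = hd ms ∸ m1 ∸ 1
  sp : suc D ≡ hd ms ∸ m1
  sp = suc[n∸m∸1]≡n∸m (nth<hd dl 1 (s≤s z≤n))

prefixF-one : ∀ {ms} → Decreasing ms → prefixF ms 1 ≈ R (hd ms ∸ nth ms 1 ∸ 1)
prefixF-one {ms} dl = ≈-trans (≡⇒≈ (cong F (take-first-layer-pred dl))) (≈-trans (F-shift (nth ms 1) _) (F-increasing≈R _))

prefixF-layer : ∀ {ms} → Decreasing ms → ∀ j → suc (suc j) < length ms
  → prefixF ms (suc (suc j)) ≈ F (layered (map (_∸ nth ms (suc (suc j))) (take (suc (suc j)) ms)))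
prefixF-layer {ms} dl j j<L = ≈-trans (≡⇒≈ (cong F (take-layered-shape dl (suc (suc j)) (s≤s z≤n) j<L))) (F-shift (nth ms (suc (suc j))) _)

prefixF-length : ∀ {a b t} → Decreasing (a ∷ b ∷ t) → prefixF (a ∷ b ∷ t) (length (a ∷ b ∷ t)) ≈ F (layered (a ∷ b ∷ t))
prefixF-length {a} {b} {t} dl = ≡⇒≈ (cong F (trans (cong (λ z → take (a ∸ z) (layered (a ∷ b ∷ t))) (nth-length t))
                                               (Lp.take-all a _ (NP.≤-reflexive (length-layered dl)))))

suffixF-layer : ∀ {ms} → Decreasing ms → ∀ j → j ≤ length ms → suffixF ms j ≈ F (layered (drop j ms))
suffixF-layer dl j j≤L = ≡⇒≈ (cong F (drop-layered-shape dl j j≤L))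

solve-linear : ∀ f p q b s → f ≈ one ⊕ X ⊛ (f ⊛ p ⊖ constS 0ℤ ⊛ f ⊕ (q ⊛ (f ⊖ b) ⊕ s))
  → (one ⊖ X ⊛ q ⊖ X ⊛ p) ⊛ f ≈ one ⊖ X ⊛ q ⊛ b ⊕ X ⊛ s
solve-linear f p q b s e = begin
    (one ⊖ X ⊛ q ⊖ X ⊛ p) ⊛ f
      ≈⟨ ⊛-cong {one ⊖ X ⊛ q ⊖ X ⊛ p} {constS 1ℤ ⊖ X ⊛ q ⊖ X ⊛ p} {f} (⊖-cong {one ⊖ X ⊛ q} (⊖-cong {one} c1 (λ n → refl)) (λ n → refl)) (λ n → refl) ⟩
    (constS 1ℤ ⊖ X ⊛ q ⊖ X ⊛ p) ⊛ f
      ≈⟨ solve 6 (λ x q p f b s → (con 1ℤ :- x :* q :- x :* p) :* f :=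
            (con 1ℤ :- x :* q :* b :+ x :* s) :+ (f :- (con 1ℤ :+ x :* (f :* p :- con 0ℤ :* f :+ (q :* (f :- b) :+ s)))))
            (λ n → refl) X q p f b s ⟩
    (constS 1ℤ ⊖ X ⊛ q ⊛ b ⊕ X ⊛ s) ⊕ (f ⊖ (constS 1ℤ ⊕ X ⊛ (f ⊛ p ⊖ constS 0ℤ ⊛ f ⊕ (q ⊛ (f ⊖ b) ⊕ s))))
      ≈⟨ ⊕-cong {constS 1ℤ ⊖ X ⊛ q ⊛ b ⊕ X ⊛ s} (λ n → refl) vanish ⟩
    (constS 1ℤ ⊖ X ⊛ q ⊛ b ⊕ X ⊛ s) ⊕ constS 0ℤ
      ≈⟨ solve 4 (λ x q b s → (con 1ℤ :- x :* q :* b :+ x :* s) :+ con 0ℤ := con 1ℤ :- x :* q :* b :+ x :* s) (λ n → refl) X q b s ⟩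
    constS 1ℤ ⊖ X ⊛ q ⊛ b ⊕ X ⊛ s
      ≈⟨ ⊕-cong {constS 1ℤ ⊖ X ⊛ q ⊛ b} (⊖-cong {constS 1ℤ} (≈-sym c1) (λ n → refl)) (λ n → refl) ⟩
    one ⊖ X ⊛ q ⊛ b ⊕ X ⊛ s ∎
  where
  open SeriesReasoning
  open SeriesSolver
  c1 : one ≈ constS 1ℤ
  c1 n = sym (ZP.*-identityˡ (one n))
  vanish : f ⊖ (constS 1ℤ ⊕ X ⊛ (f ⊛ p ⊖ constS 0ℤ ⊛ f ⊕ (q ⊛ (f ⊖ b) ⊕ s))) ≈ constS 0ℤ
  vanish n = trans (cong₂ _-ℤ_ (e n) (cong (_+ℤ (X ⊛ (f ⊛ p ⊖ constS 0ℤ ⊛ f ⊕ (q ⊛ (f ⊖ b) ⊕ s))) n) (sym (c1 n))))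
                   (trans (ZP.+-inverseʳ ((one ⊕ X ⊛ (f ⊛ p ⊖ constS 0ℤ ⊛ f ⊕ (q ⊛ (f ⊖ b) ⊕ s))) n)) (zeroS≈constS0 n))

drop-last : ∀ b t → drop (length t) (b ∷ t) ≡ nth (b ∷ t) (length t) ∷ []
drop-last b [] = refl
drop-last b (c ∷ t) = drop-last c t

layered-identity : ∀ {a b t} → Decreasing (a ∷ b ∷ t)
  → (one ⊖ X ⊛ R (a ∸ b ∸ 1) ⊖ X ⊛ R (nth (b ∷ t) (length t))) ⊛ F (layered (a ∷ b ∷ t))
    ≈ one ⊖ X ⊛ R (a ∸ b ∸ 1) ⊛ F (layered (b ∷ t))
      ⊕ X ⊛ ∑S (λ j → F (layered (map (_∸ nth t j) (take (2 + j) (a ∷ b ∷ t))))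
                        ⊛ (F (layered (drop j (b ∷ t))) ⊖ F (layered (drop j t)))) (length t)
layered-identity {a} {b} {t} dl = solve-linear (F τ) (R (nth (b ∷ t) (length t))) (R (a ∸ b ∸ 1)) (F (layered (b ∷ t))) Σ′ expansion
  where
  open SeriesReasoning
  ms : List ℕ
  ms = a ∷ b ∷ t
  τ : List ℕ
  τ = layered ms
  L : ℕ
  L = length t
  A B : ℕ → Series
  A = prefixF ms
  B = suffixF ms
  Σ′ : Series
  Σ′ = ∑S (λ j → F (layered (map (_∸ nth t j) (take (2 + j) ms))) ⊛ (F (layered (drop j (b ∷ t))) ⊖ F (layered (drop j t)))) L
  tail≈ : ∑S (λ j → A (2 + j) ⊛ (B (1 + j) ⊖ B (2 + j))) L ≈ Σ′
  tail≈ = ∑S-cong _ _ L (λ j j<L → ⊛-cong (prefixF-layer dl j (s≤s (s≤s j<L)))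
            (⊖-cong (suffixF-layer dl (1 + j) (NP.<⇒≤ (s≤s (NP.m<n⇒m<1+n j<L)))) (suffixF-layer dl (2 + j) (s≤s (s≤s (NP.<⇒≤ j<L))))))
  last≈ : B (suc L) ≈ R (nth (b ∷ t) L)
  last≈ = ≈-trans (suffixF-layer dl (suc L) (NP.n≤1+n _)) (≈-trans (≡⇒≈ (cong (λ z → F (layered z)) (drop-last b t))) (F-increasing≈R _))
  expansion : F τ ≈ one ⊕ X ⊛ (F τ ⊛ R (nth (b ∷ t) L) ⊖ constS 0ℤ ⊛ F τ ⊕ (R (a ∸ b ∸ 1) ⊛ (F τ ⊖ F (layered (b ∷ t))) ⊕ Σ′))
  expansion = begin
      F τ
        ≈⟨ F-layered-recurrence dl ⟩
      one ⊕ X ⊛ ∑S (λ j → (A (suc j) ⊖ A j) ⊛ B j) (2 + L)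
        ≈⟨ ⊕-cong {one} (λ n → refl) (⊛-cong {X} (λ n → refl) (summation-by-parts A B (suc L))) ⟩
      one ⊕ X ⊛ (A (2 + L) ⊛ B (suc L) ⊖ A 0 ⊛ B 0 ⊕ (A 1 ⊛ (B 0 ⊖ B 1) ⊕ ∑S (λ j → A (2 + j) ⊛ (B (1 + j) ⊖ B (2 + j))) L))
        ≈⟨ ⊕-cong {one} (λ n → refl) (⊛-cong {X} (λ n → refl)
             (⊕-cong (⊖-cong (⊛-cong (prefixF-length dl) last≈) (⊛-cong (≈-trans F-[] zeroS≈constS0) B0≈))
                     (⊕-cong (⊛-cong (prefixF-one dl) (⊖-cong B0≈ (suffixF-layer dl 1 (s≤s z≤n)))) tail≈))) ⟩
      one ⊕ X ⊛ (F τ ⊛ R (nth (b ∷ t) L) ⊖ constS 0ℤ ⊛ F τ ⊕ (R (a ∸ b ∸ 1) ⊛ (F τ ⊖ F (layered (b ∷ t))) ⊕ Σ′)) ∎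
    where
    B0≈ : B 0 ≈ F τ
    B0≈ n rewrite NP.n∸n≡0 a = refl

sumS-range≈∑S : ∀ r (m : ℕ → ℕ)
  → sumS (map (λ j → F (layered (map (λ i → m i ∸ m j) (range 0 (j ∸ 1))))
                     ⊛ (F (layered (map m (range (j ∸ 1) (suc r)))) ⊖ F (layered (map m (range j (suc r))))))
              (range 2 (suc r)))
    ≈ ∑S (λ j → F (layered (map (_∸ nth (applyUpTo (λ i → m (2 + i)) r) j) (take (2 + j) (applyUpTo m (2 + r)))))
              ⊛ (F (layered (drop j (applyUpTo (m ∘ suc) (suc r)))) ⊖ F (layered (drop j (applyUpTo (λ i → m (2 + i)) r))))) r
sumS-range≈∑S r m = ≈-trans (≡⇒≈ (trans (cong sumS (map-range _ 2 (suc r))) (sumS-applyUpTo _ r)))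
  (∑S-cong _ _ r (λ j j<r → ≡⇒≈ (cong₂ (λ z w → F (layered z) ⊛ w)
    (trans (map-range≡take m (suc r) (suc j) (s≤s (NP.<⇒≤ j<r)))
           (cong (λ z → map (_∸ z) (take (2 + j) (applyUpTo m (2 + r)))) (sym (nth-applyUpTo (λ i → m (2 + i)) r j j<r))))
    (cong₂ (λ z w → F (layered z) ⊖ F (layered w))
           (map-range≡drop m (suc r) (suc j) (s≤s (NP.m≤n⇒m≤1+n (NP.<⇒≤ j<r))))
           (map-range≡drop m (suc r) (2 + j) (s≤s (s≤s (NP.<⇒≤ j<r))))))))

theorem2p3 : (r : ℕ) → 1 ≤ r → (m : ℕ → ℕ)
  → (∀ i → i < r → m (suc i) < m i) → 0 < m r
  → (one ⊖ X ⊛ R (m 0 ∸ m 1 ∸ 1) ⊖ X ⊛ R (m r)) ⊛ F (layered (map m (range 0 r)))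
    ≈ one ⊖ X ⊛ R (m 0 ∸ m 1 ∸ 1) ⊛ F (layered (map m (range 1 r)))
      ⊕ X ⊛ sumS (map (λ j → F (layered (map (λ i → m i ∸ m j) (range 0 (j ∸ 1))))
                            ⊛ (F (layered (map m (range (j ∸ 1) r))) ⊖ F (layered (map m (range j r)))))
                      (range 2 r))
theorem2p3 (suc r) _ m dec mpos = begin
    (one ⊖ X ⊛ R (m 0 ∸ m 1 ∸ 1) ⊖ X ⊛ R (m (suc r))) ⊛ F (layered (map m (range 0 (suc r))))
      ≡⟨ cong₂ (λ z w → (one ⊖ X ⊛ R (m 0 ∸ m 1 ∸ 1) ⊖ X ⊛ R z) ⊛ F (layered w)) (sym last≡) (map-range≡drop m (suc r) 0 z≤n) ⟩
    (one ⊖ X ⊛ R (m 0 ∸ m 1 ∸ 1) ⊖ X ⊛ R (nth (m 1 ∷ t) (length t))) ⊛ F (layered ms)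
      ≈⟨ layered-identity (Decreasing-applyUpTo (suc r) m dec mpos) ⟩
    one ⊖ X ⊛ R (m 0 ∸ m 1 ∸ 1) ⊛ F (layered (m 1 ∷ t)) ⊕ X ⊛ ∑S term (length t)
      ≡⟨ cong₂ (λ z w → one ⊖ X ⊛ R (m 0 ∸ m 1 ∸ 1) ⊛ F (layered z) ⊕ X ⊛ ∑S term w) (map-range≡drop m (suc r) 1 (s≤s z≤n)) (sym (Lp.length-applyUpTo (λ i → m (2 + i)) r)) ⟨
    one ⊖ X ⊛ R (m 0 ∸ m 1 ∸ 1) ⊛ F (layered (map m (range 1 (suc r)))) ⊕ X ⊛ ∑S term r
      ≈⟨ ⊕-cong {one ⊖ X ⊛ R (m 0 ∸ m 1 ∸ 1) ⊛ F (layered (map m (range 1 (suc r))))} (λ n → refl) (⊛-cong {X} (λ n → refl) (≈-sym (sumS-range≈∑S r m))) ⟩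
    one ⊖ X ⊛ R (m 0 ∸ m 1 ∸ 1) ⊛ F (layered (map m (range 1 (suc r))))
      ⊕ X ⊛ sumS (map (λ j → F (layered (map (λ i → m i ∸ m j) (range 0 (j ∸ 1))))
                            ⊛ (F (layered (map m (range (j ∸ 1) (suc r)))) ⊖ F (layered (map m (range j (suc r))))))
                      (range 2 (suc r))) ∎
  where
  open SeriesReasoning
  ms : List ℕ
  ms = applyUpTo m (2 + r)
  t : List ℕ
  t = applyUpTo (λ i → m (2 + i)) r
  term : ℕ → Series
  term j = F (layered (map (_∸ nth t j) (take (2 + j) ms))) ⊛ (F (layered (drop j (m 1 ∷ t))) ⊖ F (layered (drop j t)))
  last≡ : nth (m 1 ∷ t) (length t) ≡ m (suc r)
  last≡ = trans (cong (nth (m 1 ∷ t)) (Lp.length-applyUpTo (λ i → m (2 + i)) r)) (nth-applyUpTo (m ∘ suc) (suc r) r NP.≤-refl)
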